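{- Let $\mathcal{M}_1,\mathcal{M}_2$ be $q$-matroids over $\mathbb{F}_q$ (on finite-dimensional ground spaces) with projectivizations $\mathbb{P}\mathcal{M}_1,\mathbb{P}\mathcal{M}_2$. The Whitney functions of $\mathcal{M}$ and $\mathbb{P}\mathcal{M}$ determine each other; that is, $R_{\mathcal{M}_1}=R_{\mathcal{M}_2}$ if and only if $R_{\mathbb{P}\mathcal{M}_1}=R_{\mathbb{P}\mathcal{M}_2}$.
   Context: A $q$-matroid on a finite-dimensional $\mathbb{F}_q$-vector space $E$ is $(E,\rho)$ with $\rho$ from the subspaces of $E$ to $\mathbb{N}_0$ satisfying $0\le\rho(V)\le\dim V$, $V\le W\Rightarrow\rho(V)\le\rho(W)$, and $\rho(V+W)+\rho(V\cap W)\le\rho(V)+\rho(W)$. Its Whitney function is $R_{\mathcal{M}}=\sum_{V\le E}x^{\rho(E)-\rho(V)}y^{\dim V-\rho(V)}$. The projectivization $\mathbb{P}\mathcal{M}$ is the matroid on the set $\mathbb{P}E$ of one-dimensional subspaces of $E$ with rank function $r(A)=\rho(\langle A\rangle)$, where $\langle A\rangle$ is the subspace spanned by the lines in $A$. The Whitney function of a matroid $(S,r)$ is $R=\sum_{A\subseteq S}x^{r(S)-r(A)}y^{|A|-r(A)}$. -}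

module Defs where

open import Data.Nat using (ℕ; zero; suc; _+_; _∸_; _^_; _≤_)
open import Data.Fin using (Fin; combine)
open import Data.Fin.Subset as S using (Subset; ⊤; _∩_; ∣_∣)
open import Data.Vec using (Vec; []; _∷_; zipWith; map; replicate; lookup)
open import Data.List using (List; length)
open import Data.List.Membership.Propositional as LM using ()
open import Data.List.Relation.Unary.Unique.Propositional using (Unique)
open import Data.Product using (Σ; ∃; _×_; _,_)
open import Relation.Binary.PropositionalEquality using (_≡_; _≢_)
open import Algebra.Structures using (IsCommutativeRing)
open import Function.Bundles using (_⇔_)

-- A finite field with q elements, with carrier Fin q (every finite field
-- of order q is isomorphic to one of these).

record FiniteField (q : ℕ) : Set where
  infixl 6 _+F_
  infixl 7 _*F_
  field
    _+F_ _*F_ : Fin q → Fin q → Fin q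
    -F_       : Fin q → Fin q
    0F 1F     : Fin q
    isCommutativeRing : IsCommutativeRing _≡_ _+F_ _*F_ -F_ 0F 1F
    0≢1       : 0F ≢ 1F
    inverse   : ∀ x → x ≢ 0F → ∃ λ y → x *F y ≡ 1F

Enumerates : {X : Set} → (X → Set) → List X → Set
Enumerates P L = Unique L × (∀ x → (x LM.∈ L) ⇔ P x)

HasCount : {X : Set} → (X → Set) → ℕ → Set
HasCount {X} P c = Σ (List X) λ L → Enumerates P L × length L ≡ c

SameCount : {X Y : Set} → (X → Set) → (Y → Set) → Set
SameCount P Q = ∀ c → HasCount P c ⇔ HasCount Q c

module Space {q : ℕ} (F : FiniteField q) (n : ℕ) where
  open FiniteField F

  Vect : Set
  Vect = Vec (Fin q) n

  encode : ∀ {k} → Vec (Fin q) k → Fin (q ^ k)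
  encode []       = Data.Fin.zero
  encode (a ∷ v)  = combine a (encode v)

  -- subsets of E are subsets of Fin (q ^ n) via the coding
  Sub : Set
  Sub = Subset (q ^ n)

  _∈ᵥ_ : Vect → Sub → Set
  v ∈ᵥ V = encode v S.∈ V

  𝟎 : Vect
  𝟎 = replicate n 0F

  _⊕_ : Vect → Vect → Vect
  _⊕_ = zipWith _+F_

  _·_ : Fin q → Vect → Vect
  c · v = map (c *F_) v

  IsSubspace : Sub → Set
  IsSubspace V = (𝟎 ∈ᵥ V)
               × (∀ u v → u ∈ᵥ V → v ∈ᵥ V → (u ⊕ v) ∈ᵥ V)
               × (∀ c v → v ∈ᵥ V → (c · v) ∈ᵥ V)

  lincomb : ∀ {k} → Vec (Fin q) k → Vec Vect k → Vect
  lincomb []       []       = 𝟎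
  lincomb (c ∷ cs) (b ∷ bs) = (c · b) ⊕ lincomb cs bs

  LinIndep : ∀ {k} → Vec Vect k → Set
  LinIndep {k} bs = ∀ cs → lincomb cs bs ≡ 𝟎 → cs ≡ replicate k 0F

  IsBasisOf : ∀ {k} → Sub → Vec Vect k → Set
  IsBasisOf V bs = LinIndep bs
                 × (∀ i → lookup bs i ∈ᵥ V)
                 × (∀ v → v ∈ᵥ V → ∃ λ cs → lincomb cs bs ≡ v)

  HasDim : Sub → ℕ → Set
  HasDim V k = Σ (Vec Vect k) (IsBasisOf V)

  IsSumOf : Sub → Sub → Sub → Set
  IsSumOf S V W = ∀ u → (u ∈ᵥ S) ⇔ (∃ λ v → ∃ λ w → v ∈ᵥ V × w ∈ᵥ W × u ≡ v ⊕ w)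

  IsLine : Sub → Set
  IsLine L = IsSubspace L × HasDim L 1

-- q-matroids on F_q^n.  The rank function is only constrained on subspaces
-- (its values on other subsets are irrelevant and never used).

record QMatroid {q : ℕ} (F : FiniteField q) (n : ℕ) : Set where
  open Space F n
  field
    ρ      : Sub → ℕ
    ρ-dim  : ∀ V k → IsSubspace V → HasDim V k → ρ V ≤ k
    ρ-mono : ∀ V W → IsSubspace V → IsSubspace W → V S.⊆ W → ρ V ≤ ρ W
    ρ-sub  : ∀ V W U → IsSubspace V → IsSubspace W → IsSumOf U V W →
             ρ U + ρ (V ∩ W) ≤ ρ V + ρ W

module _ {q : ℕ} {F : FiniteField q} {n : ℕ} (M : QMatroid F n) where
  open Space F n
  open QMatroid M

  -- coefficient of x^i y^j in the Whitney function R_M: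
  -- V contributes iff V is a subspace with ρ(E)-ρ(V) = i, dim V - ρ(V) = j
  WhitneyTermQ : ℕ → ℕ → Sub → Set
  WhitneyTermQ i j V = IsSubspace V × Σ ℕ λ d → HasDim V d
                       × (ρ ⊤ ∸ ρ V ≡ i) × (d ∸ ρ V ≡ j)

-- Projectivization.  The ground set PE of lines is identified with Fin m
-- through a bijective enumeration of the lines of E.

record LineEnum {q : ℕ} (F : FiniteField q) (n m : ℕ) : Set where
  open Space F n
  field
    line      : Fin m → Sub
    isLine    : ∀ a → IsLine (line a)
    injective : ∀ a b → line a ≡ line b → a ≡ b
    surjective : ∀ L → IsLine L → ∃ λ a → line a ≡ L

module _ {q : ℕ} {F : FiniteField q} {n m : ℕ} (M : QMatroid F n) (e : LineEnum F n m) where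
  open Space F n
  open QMatroid M
  open LineEnum e

  IsSpanOfLines : Sub → Subset m → Set
  IsSpanOfLines W A = IsSubspace W
                    × (∀ a → a S.∈ A → line a S.⊆ W)
                    × (∀ W′ → IsSubspace W′ → (∀ a → a S.∈ A → line a S.⊆ W′) → W S.⊆ W′)

  -- r(A) = ρ(⟨A⟩), the rank function of the projectivization PM
  ProjRank : Subset m → ℕ → Set
  ProjRank A k = Σ Sub λ W → IsSpanOfLines W A × ρ W ≡ k

  -- coefficient of x^i y^j in the Whitney function R_PM
  WhitneyTermP : ℕ → ℕ → Subset m → Set
  WhitneyTermP i j A = Σ ℕ λ rA → Σ ℕ λ rS → ProjRank A rA × ProjRank ⊤ rS
                       × (rS ∸ rA ≡ i) × (∣ A ∣ ∸ rA ≡ j)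

WhitneyEqQ : ∀ {q} {F : FiniteField q} {n₁ n₂} → QMatroid F n₁ → QMatroid F n₂ → Set
WhitneyEqQ M₁ M₂ = ∀ i j → SameCount (WhitneyTermQ M₁ i j) (WhitneyTermQ M₂ i j)

WhitneyEqP : ∀ {q} {F : FiniteField q} {n₁ n₂ m₁ m₂} →
             (M₁ : QMatroid F n₁) → LineEnum F n₁ m₁ →
             (M₂ : QMatroid F n₂) → LineEnum F n₂ m₂ → Set
WhitneyEqP M₁ e₁ M₂ e₂ = ∀ i j → SameCount (WhitneyTermP M₁ e₁ i j) (WhitneyTermP M₂ e₂ i j)

-- Group the point sets A ⊆ ℙE by the subspace W = ⟨A⟩ they span. Coordinates identify any two subspaces of the
-- same dimension together with their points, so the number of k-sets of points spanning W is a number c(dim W, k)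
-- depending only on q. Hence the number of A with r(A) = r and ∣A∣ = k is Σ_d N(r, d) c(d, k), where N(r, d) counts
-- the subspaces with ρ = r and dimension d. The matrix c is lower triangular (fewer than d points span less than
-- a d-space) with nonzero diagonal (a basis gives d spanning points), so N and these counts determine each other.
-- Each Whitney function is in turn equivalent to its table of (rank, size) counts, since the total rank is the
-- largest i for which some coefficient of xⁱ is nonzero.

module Submission where

open import Defs
open import Algebra.Bundles using (CommutativeRing)
import Algebra.Properties.CommutativeSemigroup as CommutativeSemigroup
open import Algebra.Structures using (IsCommutativeRing)
open import Data.Bool using (Bool; true; false)
import Data.Bool.Properties as Bool
open import Data.Empty using (⊥-elim)
open import Data.Fin as Fin using (Fin; combine; remQuot)
import Data.Fin.Properties as Fin
import Data.Fin.Subset as S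
open S using (Subset; ∣_∣; ⊤; ⊥)
import Data.Fin.Subset.Properties as Subsetₚ
open Subsetₚ using (_∈?_)
import Data.List as List
open import Data.List using (List; []; _∷_; length; filter; allFin; cartesianProductWith; downFrom; map)
open import Data.List.Membership.Propositional using (_∈_; _∉_)
open import Data.List.Membership.Propositional.Properties
  using (∈-filter⁺; ∈-filter⁻; ∈-allFin; ∈-cartesianProductWith⁺; ∈-map⁺; ∈-map⁻; ∈-lookup;
         ∈-downFrom⁺; ∈-downFrom⁻)
open import Data.List.Membership.Propositional.Properties.WithK using (unique∧set⇒bag)
open import Data.List.Properties using (length-++; length-map; length-removeAt′; length-tabulate)
open import Data.List.Relation.Binary.BagAndSetEquality using (∼bag⇒↭)
open import Data.List.Relation.Binary.Permutation.Propositional.Properties using (↭-length)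
open import Data.List.Relation.Unary.All as All using (All; []; _∷_)
open import Data.List.Relation.Unary.AllPairs using ([]; _∷_)
open import Data.List.Relation.Unary.Any as Any using (Any; here; there)
open import Data.List.Relation.Unary.Any.Properties using (lookup-index)
open import Data.List.Relation.Unary.Unique.Propositional using (Unique)
import Data.List.Relation.Unary.Unique.Propositional.Properties as Unique
open import Data.Nat using (ℕ; zero; suc; _+_; _*_; _∸_; _^_; _≤_; _<_; z≤n; s≤s; >-nonZero)
open import Data.Nat.Induction using (<-rec)
import Data.Nat.Properties as ℕ
open import Data.Product using (Σ; ∃; _×_; _,_; proj₁; proj₂)
open import Data.Sum using (inj₁; inj₂)
import Data.Unit as Unit
open import Data.Unit using (tt)
open import Data.Vec as Vec using (Vec; []; _∷_)
import Data.Vec.Properties as Vec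
open import Function using (_∘_; id)
open import Function.Bundles using (_⇔_; mk⇔; Equivalence)
open import Function.Properties.Equivalence using (⇔-setoid) renaming (sym to ⇔-sym; trans to ⇔-trans)
import Level
open import Relation.Binary.Definitions using (DecidableEquality; tri<; tri≈; tri>)
open import Relation.Binary.PropositionalEquality
import Relation.Binary.Reasoning.Setoid
open import Relation.Nullary using (Dec; yes; no; ¬_; does)
open import Relation.Nullary.Decidable using (_×-dec_; _→-dec_; map′)
open import Relation.Unary using (Decidable)

private
  variable
    X Y : Set

-- Counting the elements of finite types

record Listing (X : Set) : Set where
  field
    elems    : List X
    unique   : Unique elems
    complete : ∀ x → x ∈ elems
open Listing

𝟙 : {A : Set} → Dec A → ℕ
𝟙 (yes _) = 1
𝟙 (no _)  = 0

∑ : List X → (X → ℕ) → ℕ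
∑ []       w = 0
∑ (x ∷ xs) w = w x + ∑ xs w

∑-syntax : List X → (X → ℕ) → ℕ
∑-syntax = ∑

syntax ∑-syntax xs (λ x → w) = ∑[ x ← xs ] w

count : {P : X → Set} → Decidable P → List X → ℕ
count P? xs = ∑[ x ← xs ] 𝟙 (P? x)

𝟙-cong : {A B : Set} (a : Dec A) (b : Dec B) → (A → B) → (B → A) → 𝟙 a ≡ 𝟙 b
𝟙-cong (yes _) (yes _) f g = refl
𝟙-cong (yes a) (no ¬b) f g = ⊥-elim (¬b (f a))
𝟙-cong (no ¬a) (yes b) f g = ⊥-elim (¬a (g b))
𝟙-cong (no _)  (no _)  f g = refl

𝟙-no : {A : Set} (a : Dec A) → ¬ A → 𝟙 a ≡ 0
𝟙-no (yes a) ¬a = ⊥-elim (¬a a)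
𝟙-no (no _)  ¬a = refl

𝟙-× : {A B : Set} (a : Dec A) (b : Dec B) → 𝟙 (a ×-dec b) ≡ 𝟙 a * 𝟙 b
𝟙-× (yes _) (yes _) = refl
𝟙-× (yes _) (no _)  = refl
𝟙-× (no _)  _       = refl

∑-cong : ∀ (xs : List X) {v w : X → ℕ} → (∀ {x} → x ∈ xs → v x ≡ w x) → ∑ xs v ≡ ∑ xs w
∑-cong []       eq = refl
∑-cong (x ∷ xs) eq = cong₂ _+_ (eq (here refl)) (∑-cong xs (eq ∘ there))

∑-zero : ∀ (xs : List X) → ∑[ x ← xs ] 0 ≡ 0
∑-zero []       = refl
∑-zero (x ∷ xs) = ∑-zero xs

∑-+ : ∀ (xs : List X) (v w : X → ℕ) → ∑[ x ← xs ] (v x + w x) ≡ ∑ xs v + ∑ xs w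
∑-+ []       v w = refl
∑-+ (x ∷ xs) v w = trans (cong (v x + w x +_) (∑-+ xs v w))
  (CommutativeSemigroup.interchange ℕ.+-commutativeSemigroup (v x) (w x) (∑ xs v) (∑ xs w))

∑-*ʳ : ∀ (xs : List X) (w : X → ℕ) c → ∑[ x ← xs ] (w x * c) ≡ ∑ xs w * c
∑-*ʳ []       w c = refl
∑-*ʳ (x ∷ xs) w c = trans (cong (w x * c +_) (∑-*ʳ xs w c)) (sym (ℕ.*-distribʳ-+ c (w x) (∑ xs w)))

∑-*ˡ : ∀ (xs : List X) c (w : X → ℕ) → ∑[ x ← xs ] (c * w x) ≡ c * ∑ xs w
∑-*ˡ []       c w = sym (ℕ.*-zeroʳ c)
∑-*ˡ (x ∷ xs) c w = trans (cong (c * w x +_) (∑-*ˡ xs c w)) (sym (ℕ.*-distribˡ-+ c (w x) (∑ xs w)))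

∑-swap : ∀ (xs : List X) (ys : List Y) (w : X → Y → ℕ) →
         ∑[ x ← xs ] ∑ ys (w x) ≡ ∑[ y ← ys ] ∑[ x ← xs ] w x y
∑-swap []       ys w = sym (∑-zero ys)
∑-swap (x ∷ xs) ys w = trans (cong (∑ ys (w x) +_) (∑-swap xs ys w)) (sym (∑-+ ys (w x) _))

module _ (_≟_ : DecidableEquality Y) where

  ∑-δ-∉ : ∀ {y₀} (ys : List Y) → y₀ ∉ ys → ∑[ y ← ys ] 𝟙 (y₀ ≟ y) ≡ 0
  ∑-δ-∉ {y₀} []       y₀∉ = refl
  ∑-δ-∉ {y₀} (y ∷ ys) y₀∉ with y₀ ≟ y
  ... | yes y₀≡y = ⊥-elim (y₀∉ (here y₀≡y))
  ... | no _     = ∑-δ-∉ ys (y₀∉ ∘ there)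

  ∑-δ-∈ : ∀ {y₀} (ys : List Y) → Unique ys → y₀ ∈ ys → ∑[ y ← ys ] 𝟙 (y₀ ≟ y) ≡ 1
  ∑-δ-∈ {y₀} (y ∷ ys) (y∉ys ∷ u) y₀∈ with y₀ ≟ y | y₀∈
  ... | yes refl | _          = cong suc (∑-δ-∉ ys λ y∈ys → All.lookup y∉ys y∈ys refl)
  ... | no y₀≢y  | here y₀≡y  = ⊥-elim (y₀≢y y₀≡y)
  ... | no _     | there y₀∈′ = ∑-δ-∈ ys u y₀∈′

  ∑-fibres : ∀ (xs : List X) (ys : List Y) → Unique ys → (f : X → Y) (w : X → ℕ) →
             (∀ x → f x ∉ ys → w x ≡ 0) →
             ∑ xs w ≡ ∑[ y ← ys ] ∑[ x ← xs ] (𝟙 (f x ≟ y) * w x)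
  ∑-fibres xs ys u f w vanish = begin
    ∑ xs w                                       ≡⟨ ∑-cong xs (λ {x} _ → fibre x) ⟩
    ∑[ x ← xs ] ∑[ y ← ys ] (𝟙 (f x ≟ y) * w x)  ≡⟨ ∑-swap xs ys _ ⟩
    ∑[ y ← ys ] ∑[ x ← xs ] (𝟙 (f x ≟ y) * w x)  ∎
    where
    open ≡-Reasoning
    fibre : ∀ x → w x ≡ ∑[ y ← ys ] (𝟙 (f x ≟ y) * w x)
    fibre x with Any.any? (f x ≟_) ys
    ... | yes fx∈ = sym (trans (∑-*ʳ ys _ (w x)) (trans (cong (_* w x) (∑-δ-∈ ys u fx∈)) (ℕ.*-identityˡ (w x))))
    ... | no fx∉  = trans (vanish x fx∉) (sym (trans (∑-*ʳ ys _ (w x)) (cong (_* w x) (∑-δ-∉ ys fx∉))))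

module _ {P : X → Set} (P? : Decidable P) where

  count-none : (∀ x → ¬ P x) → ∀ xs → count P? xs ≡ 0
  count-none ¬P xs = trans (∑-cong xs λ {x} _ → 𝟙-no (P? x) (¬P x)) (∑-zero xs)

  count-pos : ∀ {x xs} → x ∈ xs → P x → 0 < count P? xs
  count-pos {x} {y ∷ xs} (here refl) Px with P? x
  ... | yes _  = s≤s z≤n
  ... | no ¬Px = ⊥-elim (¬Px Px)
  count-pos {x} {y ∷ xs} (there x∈) Px = ℕ.≤-trans (count-pos x∈ Px) (ℕ.m≤n+m _ (𝟙 (P? y)))

  count-witness : ∀ xs → 0 < count P? xs → ∃ P
  count-witness (x ∷ xs) pos with P? x
  ... | yes Px = x , Px
  ... | no _   = count-witness xs pos

  length-filter : ∀ xs → length (filter P? xs) ≡ count P? xs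
  length-filter []       = refl
  length-filter (x ∷ xs) with P? x
  ... | yes _ = cong suc (length-filter xs)
  ... | no _  = length-filter xs

  hasCount-count : (L : Listing X) → HasCount P (count P? (elems L))
  hasCount-count L = filter P? (elems L)
                   , (Unique.filter⁺ P? (unique L)
                     , λ x → mk⇔ (proj₂ ∘ ∈-filter⁻ P? {xs = elems L}) (∈-filter⁺ P? (complete L x)))
                   , length-filter (elems L)

hasCount-cong : {P Q : X → Set} {c : ℕ} → (∀ x → P x ⇔ Q x) → HasCount P c → HasCount Q c
hasCount-cong P⇔Q (L , (u , L⇔P) , len) = L , (u , λ x → ⇔-trans (L⇔P x) (P⇔Q x)) , len

sameCount-cong : {P P′ : X → Set} {Q Q′ : Y → Set} → (∀ x → P x ⇔ P′ x) → (∀ y → Q y ⇔ Q′ y) →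
                 SameCount P Q → SameCount P′ Q′
sameCount-cong P⇔ Q⇔ same c = mk⇔ (hasCount-cong Q⇔ ∘ Equivalence.to (same c) ∘ hasCount-cong (⇔-sym ∘ P⇔))
                                   (hasCount-cong P⇔ ∘ Equivalence.from (same c) ∘ hasCount-cong (⇔-sym ∘ Q⇔))

count-cong : {P Q : X → Set} (P? : Decidable P) (Q? : Decidable Q) →
             (∀ x → P x → Q x) → (∀ x → Q x → P x) → ∀ xs → count P? xs ≡ count Q? xs
count-cong P? Q? P⇒Q Q⇒P xs = ∑-cong xs λ {x} _ → 𝟙-cong (P? x) (Q? x) (P⇒Q x) (Q⇒P x)

enumerations-length : {P : X → Set} {L L′ : List X} → Enumerates P L → Enumerates P L′ → length L ≡ length L′
enumerations-length (uL , L⇔) (uL′ , L′⇔) =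
  ↭-length (∼bag⇒↭ (unique∧set⇒bag uL uL′ λ {x} →
    mk⇔ (Equivalence.from (L′⇔ x) ∘ Equivalence.to (L⇔ x)) (Equivalence.from (L⇔ x) ∘ Equivalence.to (L′⇔ x))))

hasCount-unique : {P : X → Set} {c c′ : ℕ} → HasCount P c → HasCount P c′ → c ≡ c′
hasCount-unique (L , enumL , refl) (L′ , enumL′ , refl) = enumerations-length enumL enumL′

sameCount⇔count≡ : {P : X → Set} {Q : Y → Set} (LX : Listing X) (LY : Listing Y) (P? : Decidable P) (Q? : Decidable Q) →
                   SameCount P Q ⇔ (count P? (elems LX) ≡ count Q? (elems LY))
sameCount⇔count≡ {P = P} {Q} LX LY P? Q? = mk⇔
  (λ same → hasCount-unique (Equivalence.to (same _) (hasCount-count P? LX)) (hasCount-count Q? LY))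
  (λ eq c → mk⇔
    (λ hasP → subst (HasCount Q) (trans (sym eq) (hasCount-unique (hasCount-count P? LX) hasP)) (hasCount-count Q? LY))
    (λ hasQ → subst (HasCount P) (trans eq (hasCount-unique (hasCount-count Q? LY) hasQ)) (hasCount-count P? LX)))

∈-─ : ∀ {y z} {ys : List Y} (y∈ : y ∈ ys) → z ∈ ys → z ≢ y → z ∈ (ys Any.─ y∈)
∈-─ (here refl) (here refl) z≢y = ⊥-elim (z≢y refl)
∈-─ (here refl) (there z∈)  z≢y = z∈
∈-─ (there y∈)  (here refl) z≢y = here refl
∈-─ (there y∈)  (there z∈)  z≢y = there (∈-─ y∈ z∈ z≢y)

matching-length-≤ : (R : X → Y → Set) (xs : List X) (ys : List Y) → Unique xs →
                    (∀ {x} → x ∈ xs → ∃ λ y → y ∈ ys × R x y) →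
                    (∀ {x x′ y} → x ∈ xs → x′ ∈ xs → R x y → R x′ y → x ≡ x′) →
                    length xs ≤ length ys
matching-length-≤ R []       ys u match inj = z≤n
matching-length-≤ R (x ∷ xs) ys (x∉xs ∷ u) match inj with match (here refl)
... | y , y∈ys , Rxy =
  subst (suc (length xs) ≤_) (sym (length-removeAt′ ys (Any.index y∈ys)))
    (s≤s (matching-length-≤ R xs (ys Any.─ y∈ys) u match′ (λ x∈ x′∈ → inj (there x∈) (there x′∈))))
  where
  match′ : ∀ {x′} → x′ ∈ xs → ∃ λ y′ → y′ ∈ (ys Any.─ y∈ys) × R x′ y′
  match′ x′∈ with match (there x′∈)
  ... | y′ , y′∈ys , Rx′y′ =
    y′ , ∈-─ y∈ys y′∈ys (λ { refl → All.lookup x∉xs x′∈ (inj (here refl) (there x′∈) Rxy Rx′y′) }) , Rx′y′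

module _ {P : X → Set} {Q : Y → Set} (LX : Listing X) (LY : Listing Y) (P? : Decidable P) (Q? : Decidable Q)
         (R : X → Y → Set) where

  count-≤-by-relation : (∀ x → P x → ∃ λ y → Q y × R x y) →
                        (∀ {x x′ y} → P x → P x′ → R x y → R x′ y → x ≡ x′) →
                        count P? (elems LX) ≤ count Q? (elems LY)
  count-≤-by-relation total injective =
    subst₂ _≤_ (length-filter P? (elems LX)) (length-filter Q? (elems LY))
      (matching-length-≤ R (filter P? (elems LX)) (filter Q? (elems LY)) (Unique.filter⁺ P? (unique LX))
        (λ {x} x∈ → let (y , Qy , Rxy) = total x (inP x∈) in y , ∈-filter⁺ Q? (complete LY y) Qy , Rxy)
        (λ x∈ x′∈ → injective (inP x∈) (inP x′∈)))
    where
    inP : ∀ {x} → x ∈ filter P? (elems LX) → P x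
    inP = proj₂ ∘ ∈-filter⁻ P? {xs = elems LX}

module _ {P : X → Set} {Q : Y → Set} (LX : Listing X) (LY : Listing Y) (P? : Decidable P) (Q? : Decidable Q) where

  count-≡-by-relation : (R : X → Y → Set) →
                        (∀ x → P x → ∃ λ y → Q y × R x y) → (∀ y → Q y → ∃ λ x → P x × R x y) →
                        (∀ {x x′ y} → P x → P x′ → R x y → R x′ y → x ≡ x′) →
                        (∀ {x y y′} → Q y → Q y′ → R x y → R x y′ → y ≡ y′) →
                        count P? (elems LX) ≡ count Q? (elems LY)
  count-≡-by-relation R totalˡ totalʳ injective functional = ℕ.≤-antisym
    (count-≤-by-relation LX LY P? Q? R totalˡ injective)
    (count-≤-by-relation LY LX Q? P? (λ y x → R x y) totalʳ functional)

all? : {P : X → Set} → Listing X → Decidable P → Dec (∀ x → P x)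
all? L P? with All.all? P? (elems L)
... | yes all = yes λ x → All.lookup all (complete L x)
... | no ¬all = no λ all → ¬all (All.tabulate λ {x} _ → all x)

any? : {P : X → Set} → Listing X → Decidable P → Dec (∃ P)
any? L P? with Any.any? P? (elems L)
... | yes some = yes (Any.satisfied some)
... | no ¬some = no λ (x , Px) → ¬some (Any.map (λ { refl → Px }) (complete L x))

finListing : ∀ n → Listing (Fin n)
finListing n = record { elems = allFin n ; unique = Unique.allFin⁺ n ; complete = ∈-allFin }

length-cartesianProductWith : ∀ {Z : Set} (f : X → Y → Z) xs ys →
                              length (cartesianProductWith f xs ys) ≡ length xs * length ys
length-cartesianProductWith f []       ys = refl
length-cartesianProductWith f (x ∷ xs) ys =
  trans (length-++ (map (f x) ys)) (cong₂ _+_ (length-map (f x) ys) (length-cartesianProductWith f xs ys))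

vecListing : Listing X → ∀ k → Listing (Vec X k)
vecListing L zero    = record { elems = [] ∷ [] ; unique = [] ∷ [] ; complete = λ { [] → here refl } }
vecListing L (suc k) = record
  { elems    = cartesianProductWith _∷_ (elems L) (elems (vecListing L k))
  ; unique   = Unique.cartesianProductWith⁺ _∷_ Vec.∷-injective (unique L) (unique (vecListing L k))
  ; complete = λ { (x ∷ xs) → ∈-cartesianProductWith⁺ _∷_ (complete L x) (complete (vecListing L k) xs) }
  }

length-vecListing : (L : Listing X) → ∀ k → length (elems (vecListing L k)) ≡ length (elems L) ^ k
length-vecListing L zero    = refl
length-vecListing L (suc k) =
  trans (length-cartesianProductWith _∷_ (elems L) _) (cong (length (elems L) *_) (length-vecListing L k))

boolListing : Listing Bool
boolListing = record
  { elems    = true ∷ false ∷ []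
  ; unique   = ((λ ()) ∷ []) ∷ [] ∷ []
  ; complete = λ { true → here refl ; false → there (here refl) }
  }

subsetListing : ∀ n → Listing (Subset n)
subsetListing = vecListing boolListing

count-all : {P : X → Set} (P? : Decidable P) → (∀ x → P x) → ∀ xs → count P? xs ≡ length xs
count-all P? all []       = refl
count-all P? all (x ∷ xs) with P? x
... | yes _  = cong suc (count-all P? all xs)
... | no ¬Px = ⊥-elim (¬Px (all x))

count-∈-tabulate : ∀ {k m} s (p : Subset m) (f : Fin k → Fin m) →
                   count (_∈? (s ∷ p)) (List.tabulate (Fin.suc ∘ f)) ≡ count (_∈? p) (List.tabulate f)
count-∈-tabulate {zero}  s p f = refl
count-∈-tabulate {suc k} s p f =
  cong₂ _+_ (𝟙-cong (Fin.suc (f Fin.zero) ∈? s ∷ p) (f Fin.zero ∈? p) Subsetₚ.drop-there Vec.there)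
            (count-∈-tabulate s p (f ∘ Fin.suc))

∣∣≡count : ∀ {m} (p : Subset m) → ∣ p ∣ ≡ count (_∈? p) (allFin m)
∣∣≡count []          = refl
∣∣≡count (true ∷ p)  = cong suc (trans (∣∣≡count p) (sym (count-∈-tabulate true p id)))
∣∣≡count (false ∷ p) = trans (∣∣≡count p) (sym (count-∈-tabulate false p id))

subsetOf : ∀ {k} {P : Fin k → Set} → Decidable P → Subset k
subsetOf P? = Vec.tabulate (does ∘ P?)

∈subsetOf⇔ : ∀ {k} {P : Fin k → Set} (P? : Decidable P) {x} → x S.∈ subsetOf P? ⇔ P x
∈subsetOf⇔ {P = P} P? {x} = mk⇔ to from
  where
  lookup-subsetOf : Vec.lookup (subsetOf P?) x ≡ does (P? x)
  lookup-subsetOf = Vec.lookup∘tabulate (does ∘ P?) x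
  to : x S.∈ subsetOf P? → P x
  to x∈ with P? x | trans (sym lookup-subsetOf) (Vec.[]=⇒lookup x∈)
  ... | yes Px | _ = Px
  to x∈ | no _ | ()
  from : P x → x S.∈ subsetOf P?
  from Px with P? x in eq
  ... | yes _  = Vec.lookup⇒[]= x _ (trans lookup-subsetOf (cong does eq))
  ... | no ¬Px = ⊥-elim (¬Px Px)

_⇔-dec_ : {A B : Set} → Dec A → Dec B → Dec (A ⇔ B)
yes a ⇔-dec yes b = yes (mk⇔ (λ _ → b) (λ _ → a))
yes a ⇔-dec no ¬b = no λ a⇔b → ¬b (Equivalence.to a⇔b a)
no ¬a ⇔-dec yes b = no λ a⇔b → ¬a (Equivalence.from a⇔b b)
no ¬a ⇔-dec no ¬b = yes (mk⇔ (⊥-elim ∘ ¬a) (⊥-elim ∘ ¬b))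

-- Vectors, subspaces and dimension over a finite field

^-injective : ∀ {b} → 1 < b → ∀ {m n} → b ^ m ≡ b ^ n → m ≡ n
^-injective {b} 1<b {m} {n} eq with ℕ.<-cmp m n
... | tri< m<n _ _ = ⊥-elim (ℕ.<-irrefl eq (ℕ.^-monoʳ-< b 1<b m<n))
... | tri≈ _ m≡n _ = m≡n
... | tri> _ _ n<m = ⊥-elim (ℕ.<-irrefl (sym eq) (ℕ.^-monoʳ-< b 1<b n<m))

^-cancelʳ-≤ : ∀ {b} → 1 < b → ∀ {m n} → b ^ m ≤ b ^ n → m ≤ n
^-cancelʳ-≤ {b} 1<b {m} {n} le with ℕ.≤-<-connex m n
... | inj₁ m≤n = m≤n
... | inj₂ n<m = ⊥-elim (ℕ.<-irrefl refl (ℕ.<-≤-trans (ℕ.^-monoʳ-< b 1<b n<m) le))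

module LinearAlgebra {q : ℕ} (F : FiniteField q) where
  open FiniteField F
  open IsCommutativeRing isCommutativeRing
    using (+-assoc; +-comm; +-identityˡ; +-identityʳ; -‿inverseʳ; *-assoc; *-comm; *-identityˡ;
           distribˡ; distribʳ; zeroˡ; zeroʳ)

  ring : CommutativeRing _ _
  ring = record { isCommutativeRing = isCommutativeRing }

  1<q : 1 < q
  1<q = lemma 0F 1F 0≢1
    where
    lemma : ∀ {k} (a b : Fin k) → a ≢ b → 1 < k
    lemma {suc zero}    Fin.zero Fin.zero a≢b = ⊥-elim (a≢b refl)
    lemma {suc (suc k)} a        b        a≢b = s≤s (s≤s z≤n)

  -1F : Fin q
  -1F = -F 1F

  +-neg1* : ∀ a → a +F -1F *F a ≡ 0F
  +-neg1* a = begin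
    a +F -1F *F a       ≡⟨ cong (_+F -1F *F a) (*-identityˡ a) ⟨
    1F *F a +F -1F *F a ≡⟨ distribʳ a 1F -1F ⟨
    (1F +F -1F) *F a    ≡⟨ cong (_*F a) (-‿inverseʳ 1F) ⟩
    0F *F a             ≡⟨ zeroˡ a ⟩
    0F                  ∎
    where open ≡-Reasoning

  infixl 6 _⊕_
  infixr 7 _·_

  _⊕_ : ∀ {k} → Vec (Fin q) k → Vec (Fin q) k → Vec (Fin q) k
  _⊕_ = Vec.zipWith _+F_

  _·_ : ∀ {k} → Fin q → Vec (Fin q) k → Vec (Fin q) k
  c · v = Vec.map (c *F_) v

  𝟎 : ∀ {k} → Vec (Fin q) k
  𝟎 = Vec.replicate _ 0F

  module _ {k : ℕ} where

    ⊕-assoc : ∀ (u v w : Vec (Fin q) k) → (u ⊕ v) ⊕ w ≡ u ⊕ (v ⊕ w)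
    ⊕-assoc = Vec.zipWith-assoc +-assoc

    ⊕-comm : ∀ (u v : Vec (Fin q) k) → u ⊕ v ≡ v ⊕ u
    ⊕-comm = Vec.zipWith-comm +-comm

    ⊕-identityˡ : ∀ (u : Vec (Fin q) k) → 𝟎 ⊕ u ≡ u
    ⊕-identityˡ = Vec.zipWith-identityˡ +-identityˡ

    ⊕-identityʳ : ∀ (u : Vec (Fin q) k) → u ⊕ 𝟎 ≡ u
    ⊕-identityʳ = Vec.zipWith-identityʳ +-identityʳ

  ⊕-interchange : ∀ {k} (u v w x : Vec (Fin q) k) → (u ⊕ v) ⊕ (w ⊕ x) ≡ (u ⊕ w) ⊕ (v ⊕ x)
  ⊕-interchange []       []       []       []       = refl
  ⊕-interchange (a ∷ u) (b ∷ v) (c ∷ w) (d ∷ x) =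
    cong₂ _∷_ (CommutativeSemigroup.interchange (CommutativeRing.+-commutativeSemigroup ring) a b c d)
              (⊕-interchange u v w x)

  ·-distribˡ-⊕ : ∀ {k} c (u v : Vec (Fin q) k) → c · (u ⊕ v) ≡ c · u ⊕ c · v
  ·-distribˡ-⊕ c []      []      = refl
  ·-distribˡ-⊕ c (a ∷ u) (b ∷ v) = cong₂ _∷_ (distribˡ c a b) (·-distribˡ-⊕ c u v)

  ·-distribʳ-+ : ∀ {k} a b (u : Vec (Fin q) k) → (a +F b) · u ≡ a · u ⊕ b · u
  ·-distribʳ-+ a b []      = refl
  ·-distribʳ-+ a b (x ∷ u) = cong₂ _∷_ (distribʳ x a b) (·-distribʳ-+ a b u)

  ·-assoc : ∀ {k} a b (u : Vec (Fin q) k) → (a *F b) · u ≡ a · b · u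
  ·-assoc a b []      = refl
  ·-assoc a b (x ∷ u) = cong₂ _∷_ (*-assoc a b x) (·-assoc a b u)

  ·-identityˡ : ∀ {k} (u : Vec (Fin q) k) → 1F · u ≡ u
  ·-identityˡ []      = refl
  ·-identityˡ (x ∷ u) = cong₂ _∷_ (*-identityˡ x) (·-identityˡ u)

  ·-zeroˡ : ∀ {k} (u : Vec (Fin q) k) → 0F · u ≡ 𝟎
  ·-zeroˡ []      = refl
  ·-zeroˡ (x ∷ u) = cong₂ _∷_ (zeroˡ x) (·-zeroˡ u)

  ·-zeroʳ : ∀ {k} c → c · 𝟎 {k} ≡ 𝟎
  ·-zeroʳ {zero}  c = refl
  ·-zeroʳ {suc k} c = cong₂ _∷_ (zeroʳ c) (·-zeroʳ c)

  ⊕-inverseʳ : ∀ {k} (u : Vec (Fin q) k) → u ⊕ -1F · u ≡ 𝟎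
  ⊕-inverseʳ []      = refl
  ⊕-inverseʳ (x ∷ u) = cong₂ _∷_ (+-neg1* x) (⊕-inverseʳ u)

  ⊕-neg≡𝟎⇒≡ : ∀ {k} (u v : Vec (Fin q) k) → u ⊕ -1F · v ≡ 𝟎 → u ≡ v
  ⊕-neg≡𝟎⇒≡ u v eq = begin
    u                     ≡⟨ ⊕-identityʳ u ⟨
    u ⊕ 𝟎                 ≡⟨ cong (u ⊕_) (trans (⊕-comm (-1F · v) v) (⊕-inverseʳ v)) ⟨
    u ⊕ (-1F · v ⊕ v)     ≡⟨ ⊕-assoc u _ v ⟨
    (u ⊕ -1F · v) ⊕ v     ≡⟨ cong (_⊕ v) eq ⟩
    𝟎 ⊕ v                 ≡⟨ ⊕-identityˡ v ⟩
    v                     ∎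
    where open ≡-Reasoning

  ⊕≡𝟎⇒≡neg : ∀ {k} (u w : Vec (Fin q) k) → u ⊕ w ≡ 𝟎 → u ≡ -1F · w
  ⊕≡𝟎⇒≡neg u w eq = begin
    u                   ≡⟨ ⊕-identityʳ u ⟨
    u ⊕ 𝟎               ≡⟨ cong (u ⊕_) (⊕-inverseʳ w) ⟨
    u ⊕ (w ⊕ -1F · w)   ≡⟨ ⊕-assoc u w _ ⟨
    (u ⊕ w) ⊕ -1F · w   ≡⟨ cong (_⊕ -1F · w) eq ⟩
    𝟎 ⊕ -1F · w         ≡⟨ ⊕-identityˡ _ ⟩
    -1F · w             ∎
    where open ≡-Reasoning

  unit : ∀ {k} → Fin k → Vec (Fin q) k
  unit Fin.zero    = 1F ∷ 𝟎
  unit (Fin.suc i) = 0F ∷ unit i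

  unit≢𝟎 : ∀ {k} (i : Fin k) → unit i ≢ 𝟎
  unit≢𝟎 Fin.zero    eq = 0≢1 (sym (Vec.∷-injectiveˡ eq))
  unit≢𝟎 (Fin.suc i) eq = unit≢𝟎 i (Vec.∷-injectiveʳ eq)

  coefficients : ∀ k → Listing (Vec (Fin q) k)
  coefficients = vecListing (finListing q)

  length-coefficients : ∀ k → length (elems (coefficients k)) ≡ q ^ k
  length-coefficients k =
    trans (length-vecListing (finListing q) k) (cong (_^ k) (length-tabulate id))

  module InSpace (n : ℕ) where
    open Space F n public hiding (_⊕_; _·_; 𝟎)

    decode : ∀ {k} → Fin (q ^ k) → Vec (Fin q) k
    decode {zero}  _ = []
    decode {suc k} x = proj₁ (remQuot {q} (q ^ k) x) ∷ decode (proj₂ (remQuot {q} (q ^ k) x))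

    encode-decode : ∀ {k} (x : Fin (q ^ k)) → encode (decode {k} x) ≡ x
    encode-decode {zero}  Fin.zero = refl
    encode-decode {suc k} x =
      trans (cong (combine (proj₁ split)) (encode-decode {k} (proj₂ split))) (Fin.combine-remQuot {q} (q ^ k) x)
      where split = remQuot {q} (q ^ k) x

    decode-encode : ∀ {k} (v : Vec (Fin q) k) → decode (encode v) ≡ v
    decode-encode []      = refl
    decode-encode (a ∷ v) = cong₂ _∷_ (cong proj₁ split) (trans (cong (decode ∘ proj₂) split) (decode-encode v))
      where split = Fin.remQuot-combine a (encode v)

    vectors : Listing Vect
    vectors = coefficients n

    _∈ᵥ?_ : ∀ v V → Dec (v ∈ᵥ V)
    v ∈ᵥ? V = encode v ∈? V

    ⊆-by-vectors : ∀ {V W : Sub} → (∀ v → v ∈ᵥ V → v ∈ᵥ W) → V S.⊆ W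
    ⊆-by-vectors {V} {W} V⊆W {x} x∈V =
      subst (S._∈ W) (encode-decode {n} x) (V⊆W (decode x) (subst (S._∈ V) (sym (encode-decode {n} x)) x∈V))

    ⟦_⟧ : {P : Vect → Set} → Decidable P → Sub
    ⟦ P? ⟧ = subsetOf (P? ∘ decode)

    ∈⟦⟧⇔ : {P : Vect → Set} (P? : Decidable P) {v : Vect} → v ∈ᵥ ⟦ P? ⟧ ⇔ P v
    ∈⟦⟧⇔ {P} P? {v} = mk⇔ (subst P (decode-encode v) ∘ Equivalence.to (∈subsetOf⇔ (P? ∘ decode)))
                          (Equivalence.from (∈subsetOf⇔ (P? ∘ decode)) ∘ subst P (sym (decode-encode v)))

    isSubspace? : Decidable IsSubspace
    isSubspace? V = (𝟎 ∈ᵥ? V)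
      ×-dec all? vectors (λ u → all? vectors λ v → (u ∈ᵥ? V) →-dec ((v ∈ᵥ? V) →-dec ((u ⊕ v) ∈ᵥ? V)))
      ×-dec all? (finListing q) (λ c → all? vectors λ v → (v ∈ᵥ? V) →-dec ((c · v) ∈ᵥ? V))

    ⊤-isSubspace : IsSubspace ⊤
    ⊤-isSubspace = Subsetₚ.∈⊤ , (λ _ _ _ _ → Subsetₚ.∈⊤) , (λ _ _ _ → Subsetₚ.∈⊤)

    lincomb-⊕ : ∀ {k} (cs ds : Vec (Fin q) k) bs → lincomb (cs ⊕ ds) bs ≡ lincomb cs bs ⊕ lincomb ds bs
    lincomb-⊕ []       []       []       = sym (⊕-identityˡ 𝟎)
    lincomb-⊕ (c ∷ cs) (d ∷ ds) (b ∷ bs) =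
      trans (cong₂ _⊕_ (·-distribʳ-+ c d b) (lincomb-⊕ cs ds bs)) (⊕-interchange _ _ _ _)

    lincomb-· : ∀ {k} a (cs : Vec (Fin q) k) bs → lincomb (a · cs) bs ≡ a · lincomb cs bs
    lincomb-· a []       []       = sym (·-zeroʳ a)
    lincomb-· a (c ∷ cs) (b ∷ bs) =
      trans (cong₂ _⊕_ (·-assoc a c b) (lincomb-· a cs bs)) (sym (·-distribˡ-⊕ a _ _))

    lincomb-𝟎 : ∀ {k} (bs : Vec Vect k) → lincomb 𝟎 bs ≡ 𝟎
    lincomb-𝟎 []       = refl
    lincomb-𝟎 (b ∷ bs) = trans (cong₂ _⊕_ (·-zeroˡ b) (lincomb-𝟎 bs)) (⊕-identityˡ 𝟎)

    lincomb-unit : ∀ {k} (bs : Vec Vect k) i → lincomb (unit i) bs ≡ Vec.lookup bs i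
    lincomb-unit (b ∷ bs) Fin.zero    = trans (cong₂ _⊕_ (·-identityˡ b) (lincomb-𝟎 bs)) (⊕-identityʳ b)
    lincomb-unit (b ∷ bs) (Fin.suc i) = trans (cong₂ _⊕_ (·-zeroˡ b) (lincomb-unit bs i)) (⊕-identityˡ _)

    lincomb-∈ : ∀ {k V} → IsSubspace V → (cs : Vec (Fin q) k) (bs : Vec Vect k) →
                (∀ i → Vec.lookup bs i ∈ᵥ V) → lincomb cs bs ∈ᵥ V
    lincomb-∈ (𝟎∈ , _ , _)            []       []       bs⊆V = 𝟎∈
    lincomb-∈ V-sub@(_ , ⊕∈ , ·∈) (c ∷ cs) (b ∷ bs) bs⊆V =
      ⊕∈ (c · b) (lincomb cs bs) (·∈ c b (bs⊆V Fin.zero)) (lincomb-∈ V-sub cs bs (bs⊆V ∘ Fin.suc))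

    lincomb-injective : ∀ {k} {bs : Vec Vect k} → LinIndep bs → ∀ cs ds → lincomb cs bs ≡ lincomb ds bs → cs ≡ ds
    lincomb-injective {bs = bs} indep cs ds eq = ⊕-neg≡𝟎⇒≡ cs ds (indep _ (begin
      lincomb (cs ⊕ -1F · ds) bs            ≡⟨ lincomb-⊕ cs _ bs ⟩
      lincomb cs bs ⊕ lincomb (-1F · ds) bs ≡⟨ cong (lincomb cs bs ⊕_) (lincomb-· -1F ds bs) ⟩
      lincomb cs bs ⊕ -1F · lincomb ds bs   ≡⟨ cong (λ v → lincomb cs bs ⊕ -1F · v) eq ⟨
      lincomb cs bs ⊕ -1F · lincomb cs bs   ≡⟨ ⊕-inverseʳ _ ⟩
      𝟎                                     ∎))
      where open ≡-Reasoning

    InSpan : ∀ {k} → Vect → Vec Vect k → Set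
    InSpan v bs = ∃ λ cs → lincomb cs bs ≡ v

    inSpan? : ∀ {k} (bs : Vec Vect k) → Decidable (λ v → InSpan v bs)
    inSpan? {k} bs v = any? (coefficients k) λ cs → Vec.≡-dec Fin._≟_ (lincomb cs bs) v

    span : ∀ {k} → Vec Vect k → Sub
    span bs = ⟦ inSpan? bs ⟧

    ∈span⇔ : ∀ {k} {bs : Vec Vect k} {v} → v ∈ᵥ span bs ⇔ InSpan v bs
    ∈span⇔ {bs = bs} {v} = ∈⟦⟧⇔ (inSpan? bs) {v}

    span-isSubspace : ∀ {k} (bs : Vec Vect k) → IsSubspace (span bs)
    span-isSubspace bs =
        from (𝟎 , lincomb-𝟎 bs)
      , (λ u v u∈ v∈ → let (cs , eq) = to u u∈ ; (ds , eq′) = to v v∈ in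
                        from (cs ⊕ ds , trans (lincomb-⊕ cs ds bs) (cong₂ _⊕_ eq eq′)))
      , (λ c v v∈ → let (cs , eq) = to v v∈ in from (c · cs , trans (lincomb-· c cs bs) (cong (c ·_) eq)))
      where
      to : ∀ v → v ∈ᵥ span bs → InSpan v bs
      to v = Equivalence.to (∈span⇔ {v = v})
      from : ∀ {v} → InSpan v bs → v ∈ᵥ span bs
      from = Equivalence.from ∈span⇔

    lookup-∈-span : ∀ {k} (bs : Vec Vect k) i → Vec.lookup bs i ∈ᵥ span bs
    lookup-∈-span bs i = Equivalence.from (∈span⇔ {v = Vec.lookup bs i}) (unit i , lincomb-unit bs i)

    span-least : ∀ {k W} (bs : Vec Vect k) → IsSubspace W → (∀ i → Vec.lookup bs i ∈ᵥ W) → span bs S.⊆ W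
    span-least {W = W} bs W-sub bs⊆W = ⊆-by-vectors λ v v∈ →
      let (cs , eq) = Equivalence.to (∈span⇔ {bs = bs} {v}) v∈ in subst (_∈ᵥ W) eq (lincomb-∈ W-sub cs bs bs⊆W)

    InSpan-∷ : ∀ {k} {bs : Vec Vect k} {v w} → InSpan w bs → InSpan w (v ∷ bs)
    InSpan-∷ {v = v} (cs , eq) = 0F ∷ cs , trans (cong₂ _⊕_ (·-zeroˡ v) eq) (⊕-identityˡ _)

    LinIndep-∷ : ∀ {k} {bs : Vec Vect k} {v} → LinIndep bs → ¬ InSpan v bs → LinIndep (v ∷ bs)
    LinIndep-∷ {bs = bs} {v} indep v∉ (c ∷ cs) eq with c Fin.≟ 0F
    ... | yes refl =
      cong (0F ∷_) (indep cs (trans (sym (trans (cong (_⊕ lincomb cs bs) (·-zeroˡ v)) (⊕-identityˡ _))) eq))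
    ... | no c≢0   = ⊥-elim (v∉ ((c⁻¹ *F -1F) · cs , (begin
      lincomb ((c⁻¹ *F -1F) · cs) bs ≡⟨ lincomb-· _ cs bs ⟩
      (c⁻¹ *F -1F) · lincomb cs bs   ≡⟨ ·-assoc c⁻¹ -1F _ ⟩
      c⁻¹ · -1F · lincomb cs bs      ≡⟨ cong (c⁻¹ ·_) (⊕≡𝟎⇒≡neg (c · v) _ eq) ⟨
      c⁻¹ · c · v                    ≡⟨ ·-assoc c⁻¹ c v ⟨
      (c⁻¹ *F c) · v                 ≡⟨ cong (_· v) (trans (*-comm c⁻¹ c) (proj₂ (inverse c c≢0))) ⟩
      1F · v                         ≡⟨ ·-identityˡ v ⟩
      v                              ∎)))
      where
      open ≡-Reasoning
      c⁻¹ = proj₁ (inverse c c≢0)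

    grow : List Vect → ∀ {k} → Vec Vect k → Σ ℕ (Vec Vect)
    grow []       bs = _ , bs
    grow (v ∷ vs) bs with inSpan? bs v
    ... | yes _ = grow vs bs
    ... | no _  = grow vs (v ∷ bs)

    grow-independent : ∀ vs {k} {bs : Vec Vect k} → LinIndep bs → LinIndep (proj₂ (grow vs bs))
    grow-independent []       indep = indep
    grow-independent (v ∷ vs) {bs = bs} indep with inSpan? bs v
    ... | yes _  = grow-independent vs indep
    ... | no v∉  = grow-independent vs (LinIndep-∷ indep v∉)

    grow-⊆ : ∀ {V} vs {k} {bs : Vec Vect k} → All (_∈ᵥ V) vs → (∀ i → Vec.lookup bs i ∈ᵥ V) →
             ∀ i → Vec.lookup (proj₂ (grow vs bs)) i ∈ᵥ V
    grow-⊆ []       []         bs⊆V = bs⊆V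
    grow-⊆ (v ∷ vs) {bs = bs} (v∈V ∷ vs⊆V) bs⊆V with inSpan? bs v
    ... | yes _ = grow-⊆ vs vs⊆V bs⊆V
    ... | no _  = grow-⊆ vs vs⊆V λ { Fin.zero → v∈V ; (Fin.suc i) → bs⊆V i }

    grow-keeps : ∀ vs {k} {bs : Vec Vect k} {w} → InSpan w bs → InSpan w (proj₂ (grow vs bs))
    grow-keeps []       w∈ = w∈
    grow-keeps (v ∷ vs) {bs = bs} w∈ with inSpan? bs v
    ... | yes _ = grow-keeps vs w∈
    ... | no _  = grow-keeps vs (InSpan-∷ w∈)

    grow-spans : ∀ vs {k} {bs : Vec Vect k} {w} → w ∈ vs → InSpan w (proj₂ (grow vs bs))
    grow-spans (v ∷ vs) {bs = bs} (here refl) with inSpan? bs v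
    ... | yes v∈ = grow-keeps vs v∈
    ... | no _   = grow-keeps vs (unit Fin.zero , lincomb-unit (v ∷ bs) Fin.zero)
    grow-spans (v ∷ vs) {bs = bs} (there w∈) with inSpan? bs v
    ... | yes _ = grow-spans vs w∈
    ... | no _  = grow-spans vs w∈

    elementsOf : Sub → List Vect
    elementsOf V = filter (_∈ᵥ? V) (elems vectors)

    dim : Sub → ℕ
    dim V = proj₁ (grow (elementsOf V) [])

    hasDim-dim : ∀ V → HasDim V (dim V)
    hasDim-dim V = proj₂ (grow (elementsOf V) [])
      , grow-independent (elementsOf V) (λ { [] _ → refl })
      , grow-⊆ (elementsOf V) (All.tabulate (proj₂ ∘ ∈-filter⁻ (_∈ᵥ? V) {xs = elems vectors})) (λ ())
      , λ v v∈ → grow-spans (elementsOf V) (∈-filter⁺ (_∈ᵥ? V) (complete vectors v) v∈)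

    card : Sub → ℕ
    card V = count (_∈ᵥ? V) (elems vectors)

    card-basis : ∀ {k V} {bs : Vec Vect k} → IsSubspace V → IsBasisOf V bs → card V ≡ q ^ k
    card-basis {k} {V} {bs} V-sub (indep , bs⊆V , spans) = sym (begin
      q ^ k                                          ≡⟨ length-coefficients k ⟨
      length (elems (coefficients k))                ≡⟨ count-all (λ _ → yes tt) (λ _ → tt) (elems (coefficients k)) ⟨
      count (λ _ → yes tt) (elems (coefficients k))  ≡⟨ count-≡-by-relation (coefficients k) vectors (λ _ → yes tt) (_∈ᵥ? V)
                                                          (λ cs v → lincomb cs bs ≡ v)
                                                          (λ cs _ → lincomb cs bs , lincomb-∈ V-sub cs bs bs⊆V , refl)
                                                          (λ v v∈ → let (cs , eq) = spans v v∈ in cs , tt , eq)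
                                                          (λ _ _ eq eq′ → lincomb-injective indep _ _ (trans eq (sym eq′)))
                                                          (λ _ _ eq eq′ → trans (sym eq) eq′) ⟩
      card V                                         ∎)
      where open ≡-Reasoning

    card-span-≤ : ∀ {k} (bs : Vec Vect k) → card (span bs) ≤ q ^ k
    card-span-≤ {k} bs = subst (card (span bs) ≤_)
      (trans (count-all (λ _ → yes tt) (λ _ → tt) (elems (coefficients k))) (length-coefficients k))
      (count-≤-by-relation vectors (coefficients k) (_∈ᵥ? span bs) (λ _ → yes tt) (λ v cs → lincomb cs bs ≡ v)
        (λ v v∈ → let (cs , eq) = Equivalence.to (∈span⇔ {v = v}) v∈ in cs , tt , eq)
        (λ _ _ eq eq′ → trans (sym eq) eq′))

    hasDim-unique : ∀ {V d d′} → IsSubspace V → HasDim V d → HasDim V d′ → d ≡ d′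
    hasDim-unique V-sub (_ , basis) (_ , basis′) =
      ^-injective 1<q (trans (sym (card-basis V-sub basis)) (card-basis V-sub basis′))

    hasDim⇔ : ∀ {V d} → IsSubspace V → HasDim V d ⇔ d ≡ dim V
    hasDim⇔ {V} V-sub = mk⇔ (λ hasDim → hasDim-unique V-sub hasDim (hasDim-dim V)) λ { refl → hasDim-dim V }

    card-dim : ∀ {V} → IsSubspace V → card V ≡ q ^ dim V
    card-dim {V} V-sub = card-basis V-sub (proj₂ (hasDim-dim V))

    dim-span-≤ : ∀ {k} (bs : Vec Vect k) → dim (span bs) ≤ k
    dim-span-≤ bs = ^-cancelʳ-≤ 1<q (subst (_≤ _) (card-dim (span-isSubspace bs)) (card-span-≤ bs))

    dim-⊤ : dim ⊤ ≡ n
    dim-⊤ = ^-injective 1<q (begin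
      q ^ dim ⊤                ≡⟨ card-dim ⊤-isSubspace ⟨
      card ⊤                   ≡⟨ count-all (_∈ᵥ? ⊤) (λ _ → Subsetₚ.∈⊤) (elems vectors) ⟩
      length (elems vectors)   ≡⟨ length-coefficients n ⟩
      q ^ n                    ∎)
      where open ≡-Reasoning

    lookup≢𝟎 : ∀ {k} {bs : Vec Vect k} → LinIndep bs → ∀ i → Vec.lookup bs i ≢ 𝟎
    lookup≢𝟎 {bs = bs} indep i eq = unit≢𝟎 i (indep (unit i) (trans (lincomb-unit bs i) eq))

    span-isLine : ∀ {v} → v ≢ 𝟎 → IsLine (span (v ∷ []))
    span-isLine {v} v≢𝟎 = span-isSubspace (v ∷ [])
      , v ∷ []
      , LinIndep-∷ (λ { [] _ → refl }) (λ { ([] , eq) → v≢𝟎 (sym eq) })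
      , lookup-∈-span (v ∷ [])
      , λ w → Equivalence.to (∈span⇔ {v = w})

-- Points of the projectivization and the subspaces they span

lookup-fromList : ∀ (xs : List X) i → Vec.lookup (Vec.fromList xs) i ≡ List.lookup xs i
lookup-fromList (x ∷ xs) Fin.zero    = refl
lookup-fromList (x ∷ xs) (Fin.suc i) = lookup-fromList xs i

_≟ₛ_ : ∀ {k} → DecidableEquality (Subset k)
_≟ₛ_ = Vec.≡-dec Bool._≟_

module Lines {q : ℕ} {F : FiniteField q} {n m : ℕ} (e : LineEnum F n m) where
  open FiniteField F using (0F)
  open LinearAlgebra F
  open InSpace n
  open LineEnum e public

  point : Fin m → Vect
  point a = Vec.lookup (proj₁ (proj₂ (isLine a))) Fin.zero

  point-∈ : ∀ a → point a ∈ᵥ line a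
  point-∈ a = proj₁ (proj₂ (proj₂ (proj₂ (isLine a)))) Fin.zero

  ∈line⇒multiple : ∀ a {v} → v ∈ᵥ line a → ∃ λ c → c · point a ≡ v
  ∈line⇒multiple a {v} v∈ with isLine a
  ... | _ , b ∷ [] , _ , _ , spans with spans v v∈
  ...   | c ∷ [] , eq = c , trans (sym (⊕-identityʳ (c · b))) eq

  point-independent : ∀ a c → c · point a ≡ 𝟎 → c ≡ 0F
  point-independent a c eq with isLine a
  ... | _ , b ∷ [] , indep , _ = Vec.∷-injectiveˡ (indep (c ∷ []) (trans (⊕-identityʳ (c · b)) eq))

  line-⊆ : ∀ a {W} → IsSubspace W → point a ∈ᵥ W → line a S.⊆ W
  line-⊆ a {W} (_ , _ , ·∈) p∈ = ⊆-by-vectors λ v v∈ →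
    let (c , eq) = ∈line⇒multiple a {v} v∈ in subst (_∈ᵥ W) eq (·∈ c (point a) p∈)

  -- IsSpanOfLines without its (unused) matroid argument.
  IsLineSpan : Sub → Subset m → Set
  IsLineSpan W A = IsSubspace W
                 × (∀ a → a S.∈ A → line a S.⊆ W)
                 × (∀ W′ → IsSubspace W′ → (∀ a → a S.∈ A → line a S.⊆ W′) → W S.⊆ W′)

  members : Subset m → List (Fin m)
  members A = filter (_∈? A) (allFin m)

  generators : (A : Subset m) → Vec Vect (length (map point (members A)))
  generators A = Vec.fromList (map point (members A))

  spanOf : Subset m → Sub
  spanOf A = span (generators A)

  lookup-generators : ∀ A i → ∃ λ a → a S.∈ A × Vec.lookup (generators A) i ≡ point a
  lookup-generators A i =
    let (a , a∈ , eq) = ∈-map⁻ point (subst (_∈ points) (sym (lookup-fromList points i)) (∈-lookup i)) in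
    a , proj₂ (∈-filter⁻ (_∈? A) {xs = allFin m} a∈) , eq
    where points = map point (members A)

  generators-complete : ∀ A a → a S.∈ A → ∃ λ i → Vec.lookup (generators A) i ≡ point a
  generators-complete A a a∈ =
    Any.index p∈ , trans (lookup-fromList (map point (members A)) (Any.index p∈)) (sym (lookup-index p∈))
    where p∈ = ∈-map⁺ point (∈-filter⁺ (_∈? A) (∈-allFin a) a∈)

  spanOf-isLineSpan : ∀ A → IsLineSpan (spanOf A) A
  spanOf-isLineSpan A = span-isSubspace (generators A)
    , (λ a a∈ → let (i , eq) = generators-complete A a a∈ in
                line-⊆ a (span-isSubspace (generators A)) (subst (_∈ᵥ spanOf A) eq (lookup-∈-span (generators A) i)))
    , λ W W-sub lines⊆W → span-least (generators A) W-sub λ i →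
        let (a , a∈ , eq) = lookup-generators A i in subst (_∈ᵥ W) (sym eq) (lines⊆W a a∈ (point-∈ a))

  spanOf-unique : ∀ {W A} → IsLineSpan W A → W ≡ spanOf A
  spanOf-unique {W} {A} (W-sub , lines⊆W , W-least) = Subsetₚ.⊆-antisym
    (W-least (spanOf A) (span-isSubspace (generators A)) (proj₁ (proj₂ (spanOf-isLineSpan A))))
    (proj₂ (proj₂ (spanOf-isLineSpan A)) W W-sub lines⊆W)

  spanOf-mono : ∀ {A B} → A S.⊆ B → spanOf A S.⊆ spanOf B
  spanOf-mono {A} {B} A⊆B = proj₂ (proj₂ (spanOf-isLineSpan A)) (spanOf B) (span-isSubspace (generators B))
    λ a a∈ → proj₁ (proj₂ (spanOf-isLineSpan B)) a (A⊆B a∈)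

  dim-spanOf-≤ : ∀ A → dim (spanOf A) ≤ ∣ A ∣
  dim-spanOf-≤ A = subst (dim (spanOf A) ≤_)
    (trans (length-map point (members A)) (trans (length-filter (_∈? A) (allFin m)) (sym (∣∣≡count A))))
    (dim-span-≤ (generators A))

  lineThrough : ∀ v → v ≢ 𝟎 → Fin m
  lineThrough v v≢𝟎 = proj₁ (surjective (span (v ∷ [])) (span-isLine v≢𝟎))

  line-lineThrough : ∀ v (v≢𝟎 : v ≢ 𝟎) → line (lineThrough v v≢𝟎) ≡ span (v ∷ [])
  line-lineThrough v v≢𝟎 = proj₂ (surjective (span (v ∷ [])) (span-isLine v≢𝟎))

  basis-lines-span : ∀ {W d} {bs : Vec Vect d} → IsSubspace W → IsBasisOf W bs →
                     ∃ λ A → IsLineSpan W A × ∣ A ∣ ≤ d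
  basis-lines-span {W} {d} {bs} W-sub (indep , bs⊆W , spans) = A , (W-sub , lines⊆W , least) , ∣A∣≤d
    where
    through : Fin d → Fin m
    through i = lineThrough (Vec.lookup bs i) (lookup≢𝟎 indep i)

    line-through : ∀ i → line (through i) ≡ span (Vec.lookup bs i ∷ [])
    line-through i = line-lineThrough (Vec.lookup bs i) (lookup≢𝟎 indep i)

    isThrough? : Decidable λ a → ∃ λ i → a ≡ through i
    isThrough? a = any? (finListing d) λ i → a Fin.≟ through i

    A : Subset m
    A = subsetOf isThrough?

    ∈A⇔ : ∀ {a} → a S.∈ A ⇔ (∃ λ i → a ≡ through i)
    ∈A⇔ = ∈subsetOf⇔ isThrough?

    lines⊆W : ∀ a → a S.∈ A → line a S.⊆ W
    lines⊆W a a∈ with i , refl ← Equivalence.to ∈A⇔ a∈ =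
      subst (S._⊆ W) (sym (line-through i)) (span-least (Vec.lookup bs i ∷ []) W-sub λ { Fin.zero → bs⊆W i })

    least : ∀ W′ → IsSubspace W′ → (∀ a → a S.∈ A → line a S.⊆ W′) → W S.⊆ W′
    least W′ W′-sub lines⊆W′ = ⊆-by-vectors λ v v∈ →
      let (cs , eq) = spans v v∈ in subst (_∈ᵥ W′) eq (lincomb-∈ W′-sub cs bs λ i →
        lines⊆W′ (through i) (Equivalence.from ∈A⇔ (i , refl))
          (subst (Vec.lookup bs i ∈ᵥ_) (sym (line-through i)) (lookup-∈-span (Vec.lookup bs i ∷ []) Fin.zero)))

    ∣A∣≤d : ∣ A ∣ ≤ d
    ∣A∣≤d = begin
      ∣ A ∣                            ≡⟨ ∣∣≡count A ⟩
      count (_∈? A) (allFin m)         ≤⟨ count-≤-by-relation (finListing m) (finListing d) (_∈? A) (λ _ → yes tt)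
                                            (λ a i → a ≡ through i)
                                            (λ a a∈ → let (i , eq) = Equivalence.to ∈A⇔ a∈ in i , tt , eq)
                                            (λ _ _ eq eq′ → trans eq (sym eq′)) ⟩
      count (λ _ → yes tt) (allFin d)  ≡⟨ count-all (λ _ → yes tt) (λ _ → tt) (allFin d) ⟩
      length (allFin d)                ≡⟨ length-tabulate id ⟩
      d                                ∎
      where open ℕ.≤-Reasoning

  spanned-by-dim-lines : ∀ {W} → IsSubspace W → ∃ λ A → spanOf A ≡ W × ∣ A ∣ ≡ dim W
  spanned-by-dim-lines {W} W-sub = A , spanA≡W , ℕ.≤-antisym ∣A∣≤dim dim≤∣A∣
    where
    lineSpan : ∃ λ A → IsLineSpan W A × ∣ A ∣ ≤ dim W
    lineSpan = basis-lines-span W-sub (proj₂ (hasDim-dim W))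
    A : Subset m
    A = proj₁ lineSpan
    spanA≡W : spanOf A ≡ W
    spanA≡W = sym (spanOf-unique (proj₁ (proj₂ lineSpan)))
    ∣A∣≤dim : ∣ A ∣ ≤ dim W
    ∣A∣≤dim = proj₂ (proj₂ lineSpan)
    dim≤∣A∣ : dim W ≤ ∣ A ∣
    dim≤∣A∣ = subst (λ U → dim U ≤ ∣ A ∣) spanA≡W (dim-spanOf-≤ A)

  SpanningSet : Sub → ℕ → Subset m → Set
  SpanningSet W k A = spanOf A ≡ W × ∣ A ∣ ≡ k

  spanningSet? : ∀ W k → Decidable (SpanningSet W k)
  spanningSet? W k A = spanOf A ≟ₛ W ×-dec (∣ A ∣ ℕ.≟ k)

  spanningSets : Sub → ℕ → ℕ
  spanningSets W k = count (spanningSet? W k) (elems (subsetListing m))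

  spanningSets-nonsubspace : ∀ {W} → ¬ IsSubspace W → ∀ k → spanningSets W k ≡ 0
  spanningSets-nonsubspace {W} ¬W-sub k = count-none (spanningSet? W k)
    (λ A (eq , _) → ¬W-sub (subst IsSubspace eq (span-isSubspace (generators A)))) (elems (subsetListing m))

  spanningSets-below-dim : ∀ {W k} → k < dim W → spanningSets W k ≡ 0
  spanningSets-below-dim {W} {k} k<dim = count-none (spanningSet? W k)
    (λ A (eq , ∣A∣≡k) → ℕ.<⇒≱ k<dim (subst₂ _≤_ (cong dim eq) ∣A∣≡k (dim-spanOf-≤ A))) (elems (subsetListing m))

  spanningSets-dim-pos : ∀ {W} → IsSubspace W → 0 < spanningSets W (dim W)
  spanningSets-dim-pos {W} W-sub =
    count-pos (spanningSet? W (dim W)) (complete (subsetListing m) (proj₁ spanning)) (proj₂ spanning)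
    where spanning = spanned-by-dim-lines W-sub

-- The number of spanning point sets depends only on the dimension

record Frame {q : ℕ} (F : FiniteField q) (d : ℕ) : Set where
  field
    n m          : ℕ
    lines        : LineEnum F n m
    V            : Space.Sub F n
    V-isSubspace : Space.IsSubspace F n V
    basis        : Vec (Space.Vect F n) d
    isBasis      : Space.IsBasisOf F n V basis

-- Frames of the same dimension are identified through coordinates: φ cs in the first matches ψ cs in the second.
module Coordinates {q : ℕ} {F : FiniteField q} {d : ℕ} (X Y : Frame F d) where
  open LinearAlgebra F
  module X = Frame X
  module Y = Frame Y
  module EX = InSpace X.n
  module EY = InSpace Y.n
  module LX = Lines X.lines
  module LY = Lines Y.lines

  φ : Vec (Fin q) d → EX.Vect
  φ cs = EX.lincomb cs X.basis

  ψ : Vec (Fin q) d → EY.Vect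
  ψ cs = EY.lincomb cs Y.basis

  φ-injective : ∀ cs ds → φ cs ≡ φ ds → cs ≡ ds
  φ-injective = EX.lincomb-injective (proj₁ X.isBasis)

  ψ-injective : ∀ cs ds → ψ cs ≡ ψ ds → cs ≡ ds
  ψ-injective = EY.lincomb-injective (proj₁ Y.isBasis)

  φ-∈ : ∀ cs → φ cs EX.∈ᵥ X.V
  φ-∈ cs = EX.lincomb-∈ X.V-isSubspace cs X.basis (proj₁ (proj₂ X.isBasis))

  φ-onto : ∀ v → v EX.∈ᵥ X.V → ∃ λ cs → φ cs ≡ v
  φ-onto = proj₂ (proj₂ X.isBasis)

  ψ-onto : ∀ v → v EY.∈ᵥ Y.V → ∃ λ cs → ψ cs ≡ v
  ψ-onto = proj₂ (proj₂ Y.isBasis)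

  PulledBack : EY.Sub → EX.Vect → Set
  PulledBack S′ v = ∃ λ cs → φ cs ≡ v × ψ cs EY.∈ᵥ S′

  pulledBack? : ∀ S′ → Decidable (PulledBack S′)
  pulledBack? S′ v = any? (coefficients d) λ cs → Vec.≡-dec Fin._≟_ (φ cs) v ×-dec (ψ cs EY.∈ᵥ? S′)

  pullback : EY.Sub → EX.Sub
  pullback S′ = EX.⟦ pulledBack? S′ ⟧

  ∈pullback⇔ : ∀ {S′ v} → v EX.∈ᵥ pullback S′ ⇔ PulledBack S′ v
  ∈pullback⇔ {S′} {v} = EX.∈⟦⟧⇔ (pulledBack? S′) {v}

  φ∈pullback⇔ : ∀ {S′} cs → φ cs EX.∈ᵥ pullback S′ ⇔ ψ cs EY.∈ᵥ S′
  φ∈pullback⇔ {S′} cs = mk⇔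
    (λ φ∈ → let (ds , eq , ψds∈) = Equivalence.to (∈pullback⇔ {v = φ cs}) φ∈ in
            subst (λ es → ψ es EY.∈ᵥ S′) (φ-injective ds cs eq) ψds∈)
    (λ ψ∈ → Equivalence.from (∈pullback⇔ {v = φ cs}) (cs , refl , ψ∈))

  pullback-⊆ : ∀ S′ → pullback S′ S.⊆ X.V
  pullback-⊆ S′ = EX.⊆-by-vectors λ v v∈ →
    let (cs , eq , _) = Equivalence.to (∈pullback⇔ {v = v}) v∈ in
    subst (EX._∈ᵥ X.V) eq (φ-∈ cs)

  pullback-isSubspace : ∀ {S′} → EY.IsSubspace S′ → EX.IsSubspace (pullback S′)
  pullback-isSubspace {S′} (𝟎∈ , ⊕∈ , ·∈) =
      from 𝟎 (𝟎 , EX.lincomb-𝟎 X.basis , subst (EY._∈ᵥ S′) (sym (EY.lincomb-𝟎 Y.basis)) 𝟎∈)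
    , (λ u v u∈ v∈ → let (cs , eq , ψcs∈) = to u u∈ ; (ds , eq′ , ψds∈) = to v v∈ in
        from (u ⊕ v) (cs ⊕ ds , trans (EX.lincomb-⊕ cs ds X.basis) (cong₂ _⊕_ eq eq′)
                    , subst (EY._∈ᵥ S′) (sym (EY.lincomb-⊕ cs ds Y.basis)) (⊕∈ (ψ cs) (ψ ds) ψcs∈ ψds∈)))
    , (λ c v v∈ → let (cs , eq , ψcs∈) = to v v∈ in
        from (c · v) (c · cs , trans (EX.lincomb-· c cs X.basis) (cong (c ·_) eq)
                    , subst (EY._∈ᵥ S′) (sym (EY.lincomb-· c cs Y.basis)) (·∈ c (ψ cs) ψcs∈)))
    where
    to : ∀ v → v EX.∈ᵥ pullback S′ → PulledBack S′ v
    to v = Equivalence.to (∈pullback⇔ {v = v})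
    from : ∀ v → PulledBack S′ v → v EX.∈ᵥ pullback S′
    from v = Equivalence.from (∈pullback⇔ {v = v})

  Corresponding : Fin X.m → Fin Y.m → Set
  Corresponding a a′ = LX.line a S.⊆ X.V × LY.line a′ S.⊆ Y.V
                     × (∀ cs → φ cs EX.∈ᵥ LX.line a ⇔ ψ cs EY.∈ᵥ LY.line a′)

  corresponding? : ∀ a a′ → Dec (Corresponding a a′)
  corresponding? a a′ = (LX.line a Subsetₚ.⊆? X.V) ×-dec (LY.line a′ Subsetₚ.⊆? Y.V)
    ×-dec all? (coefficients d) λ cs → (φ cs EX.∈ᵥ? LX.line a) ⇔-dec (ψ cs EY.∈ᵥ? LY.line a′)

  CorrespondingSets : Subset X.m → Subset Y.m → Set
  CorrespondingSets A A′ = (∀ a → a S.∈ A → LX.line a S.⊆ X.V) × (∀ a′ → a′ S.∈ A′ → LY.line a′ S.⊆ Y.V)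
                  × (∀ {a a′} → Corresponding a a′ → a S.∈ A ⇔ a′ S.∈ A′)

  pullback-isLine : ∀ a′ → LY.line a′ S.⊆ Y.V → EX.IsLine (pullback (LY.line a′))
  pullback-isLine a′ a′⊆V = pullback-isSubspace (proj₁ (LY.isLine a′))
    , φ cs₀ ∷ []
    , independent
    , (λ { Fin.zero → Equivalence.from (φ∈pullback⇔ cs₀) (subst (EY._∈ᵥ LY.line a′) (sym ψcs₀≡) (LY.point-∈ a′)) })
    , spans
    where
    cs₀ = proj₁ (ψ-onto (LY.point a′) (a′⊆V (LY.point-∈ a′)))
    ψcs₀≡ : ψ cs₀ ≡ LY.point a′
    ψcs₀≡ = proj₂ (ψ-onto (LY.point a′) (a′⊆V (LY.point-∈ a′)))

    independent : EX.LinIndep (φ cs₀ ∷ [])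
    independent (c ∷ []) eq = cong (_∷ []) (LY.point-independent a′ c (begin
      c · LY.point a′  ≡⟨ cong (c ·_) ψcs₀≡ ⟨
      c · ψ cs₀        ≡⟨ EY.lincomb-· c cs₀ Y.basis ⟨
      ψ (c · cs₀)      ≡⟨ cong ψ c·cs₀≡𝟎 ⟩
      ψ 𝟎              ≡⟨ EY.lincomb-𝟎 Y.basis ⟩
      𝟎                ∎))
      where
      open ≡-Reasoning
      c·cs₀≡𝟎 : c · cs₀ ≡ 𝟎
      c·cs₀≡𝟎 = φ-injective _ _
        (trans (EX.lincomb-· c cs₀ X.basis) (trans (sym (⊕-identityʳ _)) (trans eq (sym (EX.lincomb-𝟎 X.basis)))))

    spans : ∀ v → v EX.∈ᵥ pullback (LY.line a′) → ∃ λ cs → EX.lincomb cs (φ cs₀ ∷ []) ≡ v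
    spans v v∈ with cs , refl , ψcs∈ ← Equivalence.to (∈pullback⇔ {v = v}) v∈
                  with c , c·p≡ψcs ← LY.∈line⇒multiple a′ {ψ cs} ψcs∈ =
      c ∷ [] , trans (⊕-identityʳ _) (trans (sym (EX.lincomb-· c cs₀ X.basis)) (cong φ c·cs₀≡cs))
      where
      c·cs₀≡cs : c · cs₀ ≡ cs
      c·cs₀≡cs = ψ-injective _ _ (trans (EY.lincomb-· c cs₀ Y.basis) (trans (cong (c ·_) ψcs₀≡) c·p≡ψcs))

  partnerʳ : ∀ a′ → LY.line a′ S.⊆ Y.V → ∃ λ a → Corresponding a a′
  partnerʳ a′ a′⊆V with a , line≡ ← LX.surjective _ (pullback-isLine a′ a′⊆V) =
    a , subst (S._⊆ X.V) (sym line≡) (pullback-⊆ _) , a′⊆V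
      , λ cs → mk⇔ (λ φ∈ → Equivalence.to (φ∈pullback⇔ cs) (subst (φ cs EX.∈ᵥ_) line≡ φ∈))
                   (λ ψ∈ → subst (φ cs EX.∈ᵥ_) (sym line≡) (Equivalence.from (φ∈pullback⇔ cs) ψ∈))

  corresponding-functional : ∀ {a a₁ a₂} → Corresponding a a₁ → Corresponding a a₂ → a₁ ≡ a₂
  corresponding-functional (_ , a₁⊆V , a≈a₁) (_ , a₂⊆V , a≈a₂) =
    LY.injective _ _ (Subsetₚ.⊆-antisym (transfer a≈a₁ a≈a₂ a₁⊆V) (transfer a≈a₂ a≈a₁ a₂⊆V))
    where
    transfer : ∀ {a a₁ a₂} → (∀ cs → φ cs EX.∈ᵥ LX.line a ⇔ ψ cs EY.∈ᵥ LY.line a₁) →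
               (∀ cs → φ cs EX.∈ᵥ LX.line a ⇔ ψ cs EY.∈ᵥ LY.line a₂) →
               LY.line a₁ S.⊆ Y.V → LY.line a₁ S.⊆ LY.line a₂
    transfer {a₁ = a₁} {a₂} a≈a₁ a≈a₂ a₁⊆V = EY.⊆-by-vectors λ v v∈ →
      let (cs , eq) = ψ-onto v (a₁⊆V v∈) in
      subst (EY._∈ᵥ LY.line a₂) eq
        (Equivalence.to (a≈a₂ cs) (Equivalence.from (a≈a₁ cs) (subst (EY._∈ᵥ LY.line a₁) (sym eq) v∈)))

module Correspondence {q : ℕ} {F : FiniteField q} {d : ℕ} (X Y : Frame F d) where
  open Coordinates X Y public
  module Back = Coordinates Y X

  flip-corresponding : ∀ {a a′} → Back.Corresponding a′ a → Corresponding a a′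
  flip-corresponding (a′⊆V , a⊆V , a′≈a) = a⊆V , a′⊆V , λ cs → ⇔-sym (a′≈a cs)

  unflip-corresponding : ∀ {a a′} → Corresponding a a′ → Back.Corresponding a′ a
  unflip-corresponding (a⊆V , a′⊆V , a≈a′) = a′⊆V , a⊆V , λ cs → ⇔-sym (a≈a′ cs)

  flip-correspondingSets : ∀ {A A′} → Back.CorrespondingSets A′ A → CorrespondingSets A A′
  flip-correspondingSets (A′⊆V , A⊆V , A′≈A) = A⊆V , A′⊆V , λ a≈a′ → ⇔-sym (A′≈A (unflip-corresponding a≈a′))

  partnerˡ : ∀ a → LX.line a S.⊆ X.V → ∃ λ a′ → Corresponding a a′
  partnerˡ a a⊆V = let (a′ , a′≈a) = Back.partnerʳ a a⊆V in a′ , flip-corresponding a′≈a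

  corresponding-injective : ∀ {a₁ a₂ a′} → Corresponding a₁ a′ → Corresponding a₂ a′ → a₁ ≡ a₂
  corresponding-injective a₁≈a′ a₂≈a′ =
    Back.corresponding-functional (unflip-corresponding a₁≈a′) (unflip-corresponding a₂≈a′)

  InImage : Subset X.m → Fin Y.m → Set
  InImage A a′ = ∃ λ a → Corresponding a a′ × a S.∈ A

  inImage? : ∀ A → Decidable (InImage A)
  inImage? A a′ = any? (finListing X.m) λ a → corresponding? a a′ ×-dec (a ∈? A)

  image : Subset X.m → Subset Y.m
  image A = subsetOf (inImage? A)

  correspondingSets-image : ∀ {A} → (∀ a → a S.∈ A → LX.line a S.⊆ X.V) → CorrespondingSets A (image A)
  correspondingSets-image {A} A⊆V = A⊆V
    , (λ a′ a′∈ → let (_ , (_ , a′⊆V , _) , _) = to a′∈ in a′⊆V)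
    , λ {a} {a′} a≈a′ → mk⇔ (λ a∈ → from (a , a≈a′ , a∈))
                            (λ a′∈ → let (b , b≈a′ , b∈) = to a′∈ in
                                     subst (S._∈ A) (corresponding-injective b≈a′ a≈a′) b∈)
    where
    to : ∀ {a′} → a′ S.∈ image A → InImage A a′
    to = Equivalence.to (∈subsetOf⇔ (inImage? A))
    from : ∀ {a′} → InImage A a′ → a′ S.∈ image A
    from = Equivalence.from (∈subsetOf⇔ (inImage? A))

  correspondingSets-functional : ∀ {A A₁ A₂} → CorrespondingSets A A₁ → CorrespondingSets A A₂ → A₁ ≡ A₂
  correspondingSets-functional (_ , A₁⊆V , A≈A₁) (_ , A₂⊆V , A≈A₂) =
    Subsetₚ.⊆-antisym (transfer A₁⊆V A≈A₁ A≈A₂) (transfer A₂⊆V A≈A₂ A≈A₁)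
    where
    transfer : ∀ {A A₁ A₂} → (∀ a′ → a′ S.∈ A₁ → LY.line a′ S.⊆ Y.V) →
               (∀ {a a′} → Corresponding a a′ → a S.∈ A ⇔ a′ S.∈ A₁) →
               (∀ {a a′} → Corresponding a a′ → a S.∈ A ⇔ a′ S.∈ A₂) → A₁ S.⊆ A₂
    transfer A₁⊆V A≈A₁ A≈A₂ {a′} a′∈ =
      let (a , a≈a′) = partnerʳ a′ (A₁⊆V a′ a′∈) in
      Equivalence.to (A≈A₂ a≈a′) (Equivalence.from (A≈A₁ a≈a′) a′∈)

  correspondingSets-∣∣ : ∀ {A A′} → CorrespondingSets A A′ → ∣ A ∣ ≡ ∣ A′ ∣
  correspondingSets-∣∣ {A} {A′} (A⊆V , A′⊆V , A≈A′) = begin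
    ∣ A ∣                      ≡⟨ ∣∣≡count A ⟩
    count (_∈? A) (allFin X.m)   ≡⟨ count-≡-by-relation (finListing X.m) (finListing Y.m) (_∈? A) (_∈? A′) Corresponding
                                      (λ a a∈ → let (a′ , a≈a′) = partnerˡ a (A⊆V a a∈) in
                                                a′ , Equivalence.to (A≈A′ a≈a′) a∈ , a≈a′)
                                      (λ a′ a′∈ → let (a , a≈a′) = partnerʳ a′ (A′⊆V a′ a′∈) in
                                                  a , Equivalence.from (A≈A′ a≈a′) a′∈ , a≈a′)
                                      (λ _ _ → corresponding-injective)
                                      (λ _ _ → corresponding-functional) ⟩
    count (_∈? A′) (allFin Y.m)  ≡⟨ ∣∣≡count A′ ⟨
    ∣ A′ ∣                     ∎
    where open ≡-Reasoning

  correspondingSets-lineSpan : ∀ {A A′} → CorrespondingSets A A′ → LX.IsLineSpan X.V A → LY.IsLineSpan Y.V A′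
  correspondingSets-lineSpan {A} {A′} (A⊆V , A′⊆V , A≈A′) (_ , _ , V-least) = Y.V-isSubspace , A′⊆V , V′-least
    where
    V′-least : ∀ W → EY.IsSubspace W → (∀ a′ → a′ S.∈ A′ → LY.line a′ S.⊆ W) → Y.V S.⊆ W
    V′-least W W-sub A′⊆W = EY.⊆-by-vectors λ v v∈ →
      let (cs , eq) = ψ-onto v v∈ in
      subst (EY._∈ᵥ W) eq (Equivalence.to (φ∈pullback⇔ cs) (V⊆pullback (φ-∈ cs)))
      where
      A⊆pullback : ∀ a → a S.∈ A → LX.line a S.⊆ pullback W
      A⊆pullback a a∈ = EX.⊆-by-vectors λ v v∈ →
        let (a′ , a≈a′) = partnerˡ a (A⊆V a a∈)
            (cs , eq) = φ-onto v (A⊆V a a∈ v∈) in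
        subst (EX._∈ᵥ pullback W) eq (Equivalence.from (φ∈pullback⇔ cs)
          (A′⊆W a′ (Equivalence.to (A≈A′ a≈a′) a∈)
            (Equivalence.to (proj₂ (proj₂ a≈a′) cs) (subst (EX._∈ᵥ LX.line a) (sym eq) v∈))))
      V⊆pullback : X.V S.⊆ pullback W
      V⊆pullback = V-least (pullback W) (pullback-isSubspace W-sub) A⊆pullback

  spanningSet-partner : ∀ {k A} → LX.SpanningSet X.V k A →
                        ∃ λ A′ → LY.SpanningSet Y.V k A′ × CorrespondingSets A A′
  spanningSet-partner {k} {A} (spanA≡V , ∣A∣≡k) = image A
    , (sym (LY.spanOf-unique (correspondingSets-lineSpan A≈A′ A-spans)) , trans (sym (correspondingSets-∣∣ A≈A′)) ∣A∣≡k)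
    , A≈A′
    where
    A-spans : LX.IsLineSpan X.V A
    A-spans = subst (λ W → LX.IsLineSpan W A) spanA≡V (LX.spanOf-isLineSpan A)
    A≈A′ : CorrespondingSets A (image A)
    A≈A′ = correspondingSets-image (proj₁ (proj₂ A-spans))

spanningSets-invariant : ∀ {q} {F : FiniteField q} {d} (X Y : Frame F d) k →
                         Lines.spanningSets (Frame.lines X) (Frame.V X) k ≡ Lines.spanningSets (Frame.lines Y) (Frame.V Y) k
spanningSets-invariant X Y k = count-≡-by-relation (subsetListing X.m) (subsetListing Y.m) _ _ XY.CorrespondingSets
  (λ _ → XY.spanningSet-partner)
  (λ _ A′-spans → let (A , A-spans , A′≈A) = YX.spanningSet-partner A′-spans in
                  A , A-spans , XY.flip-correspondingSets A′≈A)
  (λ _ _ A₁≈A′ A₂≈A′ →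
    YX.correspondingSets-functional (YX.flip-correspondingSets A₁≈A′) (YX.flip-correspondingSets A₂≈A′))
  (λ _ _ → XY.correspondingSets-functional)
  where
  module XY = Correspondence X Y
  module YX = Correspondence Y X
  module X = Frame X
  module Y = Frame Y

lookup-injective : ∀ {xs : List X} → Unique xs → ∀ i j → List.lookup xs i ≡ List.lookup xs j → i ≡ j
lookup-injective {xs = x ∷ xs} (x∉ ∷ u) Fin.zero    Fin.zero    eq = refl
lookup-injective {xs = x ∷ xs} (x∉ ∷ u) Fin.zero    (Fin.suc j) eq = ⊥-elim (All.lookup x∉ (∈-lookup j) eq)
lookup-injective {xs = x ∷ xs} (x∉ ∷ u) (Fin.suc i) Fin.zero    eq = ⊥-elim (All.lookup x∉ (∈-lookup i) (sym eq))
lookup-injective {xs = x ∷ xs} (x∉ ∷ u) (Fin.suc i) (Fin.suc j) eq = cong Fin.suc (lookup-injective u i j eq)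

module Canonical {q : ℕ} (F : FiniteField q) (d : ℕ) where
  open LinearAlgebra F
  open InSpace d

  isLine? : Decidable IsLine
  isLine? W with isSubspace? W
  ... | yes W-sub = map′ (λ 1≡dim → W-sub , Equivalence.from (hasDim⇔ W-sub) 1≡dim)
                      (λ (_ , hasDim) → Equivalence.to (hasDim⇔ W-sub) hasDim) (1 ℕ.≟ dim W)
  ... | no ¬W-sub = no (¬W-sub ∘ proj₁)

  allLines : List Sub
  allLines = filter isLine? (elems (subsetListing (q ^ d)))

  lineEnum : LineEnum F d (length allLines)
  lineEnum = record
    { line       = List.lookup allLines
    ; isLine     = λ a → proj₂ (∈-filter⁻ isLine? {xs = elems (subsetListing (q ^ d))} (∈-lookup a))
    ; injective  = lookup-injective (Unique.filter⁺ isLine? (unique (subsetListing (q ^ d))))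
    ; surjective = λ L L-line → let L∈ = ∈-filter⁺ isLine? (complete (subsetListing (q ^ d)) L) L-line in
                                Any.index L∈ , sym (lookup-index L∈)
    }

  frame : Frame F d
  frame = record
    { n = d ; m = length allLines ; lines = lineEnum ; V = ⊤ ; V-isSubspace = ⊤-isSubspace
    ; basis = proj₁ basis ; isBasis = proj₂ basis }
    where
    basis : HasDim ⊤ d
    basis = subst (HasDim ⊤) dim-⊤ (hasDim-dim ⊤)

spanningCount : ∀ {q} → FiniteField q → ℕ → ℕ → ℕ
spanningCount F d k = Lines.spanningSets (Canonical.lineEnum F d) ⊤ k

spanningCount-below : ∀ {q} (F : FiniteField q) {d k} → k < d → spanningCount F d k ≡ 0
spanningCount-below F {d} {k} k<d =
  Lines.spanningSets-below-dim (Canonical.lineEnum F d) (subst (k <_) (sym (LinearAlgebra.InSpace.dim-⊤ F d)) k<d)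

spanningCount-diagonal : ∀ {q} (F : FiniteField q) d → 0 < spanningCount F d d
spanningCount-diagonal F d = subst (λ k → 0 < spanningCount F d k) (InSpace.dim-⊤)
  (Lines.spanningSets-dim-pos (Canonical.lineEnum F d) InSpace.⊤-isSubspace)
  where module InSpace = LinearAlgebra.InSpace F d

module _ {q : ℕ} {F : FiniteField q} {n m : ℕ} (e : LineEnum F n m) where
  open LinearAlgebra F
  open InSpace n
  open Lines e

  spanningSets-dim : ∀ {W} → IsSubspace W → ∀ k → spanningSets W k ≡ spanningCount F (dim W) k
  spanningSets-dim {W} W-sub = spanningSets-invariant frameW (Canonical.frame F (dim W))
    where
    frameW : Frame F (dim W)
    frameW = record { n = n ; m = m ; lines = e ; V = W ; V-isSubspace = W-sub
                    ; basis = proj₁ (hasDim-dim W) ; isBasis = proj₂ (hasDim-dim W) }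

-- Whitney coefficients and rank–size profiles

-- Common shape of the two Whitney functions: coefficient i j is the coefficient of xⁱ yʲ in
-- Σ x^(top ∸ rank) y^(size ∸ rank) over the members, which are the subspaces of a q-matroid (rank ρ, size dim)
-- or the point sets of its projectivization (rank r, size ∣A∣).
record RankedFamily : Set₁ where
  field
    Carrier   : Set
    listing   : Listing Carrier
    Member    : Carrier → Set
    member?   : Decidable Member
    rank size : Carrier → ℕ
    top       : ℕ
    rank≤top  : ∀ {x} → Member x → rank x ≤ top
    rank≤size : ∀ {x} → Member x → rank x ≤ size x
    rankless  : ∃ λ x → Member x × rank x ≡ 0
    topmost   : ∃ λ x → Member x × rank x ≡ top

  WhitneyTerm : ℕ → ℕ → Carrier → Set
  WhitneyTerm i j x = Member x × top ∸ rank x ≡ i × size x ∸ rank x ≡ j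

  whitneyTerm? : ∀ i j → Decidable (WhitneyTerm i j)
  whitneyTerm? i j x = member? x ×-dec top ∸ rank x ℕ.≟ i ×-dec size x ∸ rank x ℕ.≟ j

  coefficient : ℕ → ℕ → ℕ
  coefficient i j = count (whitneyTerm? i j) (elems listing)

  HasProfile : ℕ → ℕ → Carrier → Set
  HasProfile r s x = Member x × rank x ≡ r × size x ≡ s

  hasProfile? : ∀ r s → Decidable (HasProfile r s)
  hasProfile? r s x = member? x ×-dec rank x ℕ.≟ r ×-dec size x ℕ.≟ s

  profile : ℕ → ℕ → ℕ
  profile r s = count (hasProfile? r s) (elems listing)

  coefficient≡profile : ∀ {i} j → i ≤ top → coefficient i j ≡ profile (top ∸ i) (j + (top ∸ i))
  coefficient≡profile {i} j i≤top = count-cong (whitneyTerm? i j) (hasProfile? (top ∸ i) (j + (top ∸ i)))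
    (λ x (mem , top∸rank≡i , size∸rank≡j) →
      let rank≡ = trans (sym (ℕ.m∸[m∸n]≡n (rank≤top mem))) (cong (top ∸_) top∸rank≡i) in
      mem , rank≡ , trans (sym (ℕ.m∸n+n≡m (rank≤size mem))) (cong₂ _+_ size∸rank≡j rank≡))
    (λ x (mem , rank≡ , size≡) →
      mem , trans (cong (top ∸_) rank≡) (ℕ.m∸[m∸n]≡n i≤top) , trans (cong₂ _∸_ size≡ rank≡) (ℕ.m+n∸n≡m j (top ∸ i)))
    (elems listing)

  profile≡coefficient : ∀ {r s} → r ≤ top → r ≤ s → profile r s ≡ coefficient (top ∸ r) (s ∸ r)
  profile≡coefficient {r} {s} r≤top r≤s = sym (trans (coefficient≡profile (s ∸ r) (ℕ.m∸n≤m top r))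
    (cong₂ profile (ℕ.m∸[m∸n]≡n r≤top) (trans (cong ((s ∸ r) +_) (ℕ.m∸[m∸n]≡n r≤top)) (ℕ.m∸n+n≡m r≤s))))

  coefficient-beyond-top : ∀ {i} j → top < i → coefficient i j ≡ 0
  coefficient-beyond-top j top<i = count-none (whitneyTerm? _ j)
    (λ x (_ , top∸rank≡i , _) → ℕ.<⇒≱ top<i (subst (_≤ top) top∸rank≡i (ℕ.m∸n≤m top (rank x)))) (elems listing)

  profile-beyond-top : ∀ {r} s → top < r → profile r s ≡ 0
  profile-beyond-top {r} s top<r = count-none (hasProfile? r s)
    (λ x (mem , rank≡r , _) → ℕ.<⇒≱ top<r (subst (_≤ top) rank≡r (rank≤top mem))) (elems listing)

  profile-beyond-size : ∀ {r s} → s < r → profile r s ≡ 0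
  profile-beyond-size {r} {s} s<r = count-none (hasProfile? r s)
    (λ x (mem , rank≡r , size≡s) → ℕ.<⇒≱ s<r (subst₂ _≤_ rank≡r size≡s (rank≤size mem))) (elems listing)

  coefficient-pos⇒≤top : ∀ {i j} → 0 < coefficient i j → i ≤ top
  coefficient-pos⇒≤top {i} {j} pos = let (x , _ , top∸rank≡i , _) = count-witness (whitneyTerm? i j) (elems listing) pos in
    subst (_≤ top) top∸rank≡i (ℕ.m∸n≤m top (rank x))

  profile-pos⇒≤top : ∀ {r s} → 0 < profile r s → r ≤ top
  profile-pos⇒≤top {r} {s} pos = let (x , mem , rank≡r , _) = count-witness (hasProfile? r s) (elems listing) pos in
    subst (_≤ top) rank≡r (rank≤top mem)

  top-coefficient-pos : ∃ λ j → 0 < coefficient top j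
  top-coefficient-pos = let (x , mem , rank≡0) = rankless in
    size x , count-pos (whitneyTerm? top (size x)) (complete listing x)
                       (mem , cong (top ∸_) rank≡0 , cong (size x ∸_) rank≡0)

  top-profile-pos : ∃ λ s → 0 < profile top s
  top-profile-pos = let (x , mem , rank≡top) = topmost in
    size x , count-pos (hasProfile? top (size x)) (complete listing x) (mem , rank≡top , refl)

open RankedFamily using (coefficient; profile; top)

SameCoefficients : RankedFamily → RankedFamily → Set
SameCoefficients Φ Ψ = ∀ i j → coefficient Φ i j ≡ coefficient Ψ i j

SameProfiles : RankedFamily → RankedFamily → Set
SameProfiles Φ Ψ = ∀ r s → profile Φ r s ≡ profile Ψ r s

module _ (Φ Ψ : RankedFamily) where
  private
    module Φ = RankedFamily Φ
    module Ψ = RankedFamily Ψ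

  top-≤-by-coefficients : SameCoefficients Φ Ψ → Φ.top ≤ Ψ.top
  top-≤-by-coefficients same = let (j , pos) = Φ.top-coefficient-pos in
    Ψ.coefficient-pos⇒≤top (subst (0 <_) (same Φ.top j) pos)

  top-≤-by-profiles : SameProfiles Φ Ψ → Φ.top ≤ Ψ.top
  top-≤-by-profiles same = let (s , pos) = Φ.top-profile-pos in
    Ψ.profile-pos⇒≤top (subst (0 <_) (same Φ.top s) pos)

sameCoefficients⇒sameTop : ∀ Φ Ψ → SameCoefficients Φ Ψ → top Φ ≡ top Ψ
sameCoefficients⇒sameTop Φ Ψ same =
  ℕ.≤-antisym (top-≤-by-coefficients Φ Ψ same) (top-≤-by-coefficients Ψ Φ λ i j → sym (same i j))

sameProfiles⇒sameTop : ∀ Φ Ψ → SameProfiles Φ Ψ → top Φ ≡ top Ψ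
sameProfiles⇒sameTop Φ Ψ same =
  ℕ.≤-antisym (top-≤-by-profiles Φ Ψ same) (top-≤-by-profiles Ψ Φ λ r s → sym (same r s))

sameCoefficients⇔sameProfiles : (Φ Ψ : RankedFamily) → SameCoefficients Φ Ψ ⇔ SameProfiles Φ Ψ
sameCoefficients⇔sameProfiles Φ Ψ = mk⇔
  (λ same → profiles (sameCoefficients⇒sameTop Φ Ψ same) same)
  (λ same → coefficients (sameProfiles⇒sameTop Φ Ψ same) same)
  where
  module Φ = RankedFamily Φ
  module Ψ = RankedFamily Ψ

  profiles : Φ.top ≡ Ψ.top → SameCoefficients Φ Ψ → SameProfiles Φ Ψ
  profiles tops same r s with r ℕ.≤? Φ.top | r ℕ.≤? s
  ... | yes r≤top | yes r≤s = begin
    Φ.profile r s                       ≡⟨ Φ.profile≡coefficient r≤top r≤s ⟩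
    Φ.coefficient (Φ.top ∸ r) (s ∸ r)   ≡⟨ same _ _ ⟩
    Ψ.coefficient (Φ.top ∸ r) (s ∸ r)   ≡⟨ cong (λ t → Ψ.coefficient (t ∸ r) (s ∸ r)) tops ⟩
    Ψ.coefficient (Ψ.top ∸ r) (s ∸ r)   ≡⟨ Ψ.profile≡coefficient (subst (r ≤_) tops r≤top) r≤s ⟨
    Ψ.profile r s                       ∎
    where open ≡-Reasoning
  ... | no r≰top | _ =
    trans (Φ.profile-beyond-top s (ℕ.≰⇒> r≰top)) (sym (Ψ.profile-beyond-top s (subst (_< r) tops (ℕ.≰⇒> r≰top))))
  ... | yes _ | no r≰s = trans (Φ.profile-beyond-size (ℕ.≰⇒> r≰s)) (sym (Ψ.profile-beyond-size (ℕ.≰⇒> r≰s)))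

  coefficients : Φ.top ≡ Ψ.top → SameProfiles Φ Ψ → SameCoefficients Φ Ψ
  coefficients tops same i j with i ℕ.≤? Φ.top
  ... | yes i≤top = begin
    Φ.coefficient i j                         ≡⟨ Φ.coefficient≡profile j i≤top ⟩
    Φ.profile (Φ.top ∸ i) (j + (Φ.top ∸ i))   ≡⟨ same _ _ ⟩
    Ψ.profile (Φ.top ∸ i) (j + (Φ.top ∸ i))   ≡⟨ cong (λ t → Ψ.profile (t ∸ i) (j + (t ∸ i))) tops ⟩
    Ψ.profile (Ψ.top ∸ i) (j + (Ψ.top ∸ i))   ≡⟨ Ψ.coefficient≡profile j (subst (i ≤_) tops i≤top) ⟨
    Ψ.coefficient i j                         ∎
    where open ≡-Reasoning
  ... | no i≰top =
    trans (Φ.coefficient-beyond-top j (ℕ.≰⇒> i≰top)) (sym (Ψ.coefficient-beyond-top j (subst (_< i) tops (ℕ.≰⇒> i≰top))))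

triangular-injective : (c : ℕ → ℕ → ℕ) → (∀ d → 0 < c d d) → (f g : ℕ → ℕ) →
                       (∀ k → ∑[ d ← downFrom (suc k) ] (f d * c d k) ≡ ∑[ d ← downFrom (suc k) ] (g d * c d k)) →
                       ∀ d → f d ≡ g d
triangular-injective c diagonal f g same = <-rec (λ d → f d ≡ g d) step
  where
  step : ∀ k → (∀ {d} → d < k → f d ≡ g d) → f k ≡ g k
  step k below = ℕ.*-cancelʳ-≡ (f k) (g k) (c k k) {{>-nonZero (diagonal k)}}
    (ℕ.+-cancelʳ-≡ _ (f k * c k k) (g k * c k k)
      (trans (same k) (cong (g k * c k k +_) (sym (∑-cong (downFrom k) λ d∈ → cong (_* c _ k) (below (∈-downFrom⁻ d∈)))))))

whitneyEq⇔sameCoefficients : (Φ Ψ : RankedFamily) {P : ℕ → ℕ → RankedFamily.Carrier Φ → Set}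
                             {Q : ℕ → ℕ → RankedFamily.Carrier Ψ → Set} →
                             (∀ i j x → P i j x ⇔ RankedFamily.WhitneyTerm Φ i j x) →
                             (∀ i j y → Q i j y ⇔ RankedFamily.WhitneyTerm Ψ i j y) →
                             (∀ i j → SameCount (P i j) (Q i j)) ⇔ SameCoefficients Φ Ψ
whitneyEq⇔sameCoefficients Φ Ψ P⇔ Q⇔ = mk⇔
  (λ same i j → Equivalence.to (counts⇔ i j) (sameCount-cong (P⇔ i j) (Q⇔ i j) (same i j)))
  (λ same i j → sameCount-cong (⇔-sym ∘ P⇔ i j) (⇔-sym ∘ Q⇔ i j) (Equivalence.from (counts⇔ i j) (same i j)))
  where
  module Φ = RankedFamily Φ
  module Ψ = RankedFamily Ψ
  counts⇔ : ∀ i j → SameCount (Φ.WhitneyTerm i j) (Ψ.WhitneyTerm i j) ⇔ (Φ.coefficient i j ≡ Ψ.coefficient i j)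
  counts⇔ i j = sameCount⇔count≡ Φ.listing Ψ.listing (Φ.whitneyTerm? i j) (Ψ.whitneyTerm? i j)

-- The subspaces and the point sets of a q-matroid

module Matroid {q : ℕ} {F : FiniteField q} {n : ℕ} (M : QMatroid F n) where
  open LinearAlgebra F
  open InSpace n
  open QMatroid M

  ρ-zero : ρ (span []) ≡ 0
  ρ-zero = ℕ.n≤0⇒n≡0 (ρ-dim (span []) 0 (span-isSubspace [])
    ([] , (λ { [] _ → refl }) , (λ ()) , λ v → Equivalence.to (∈span⇔ {v = v})))

  subspaceFamily : RankedFamily
  subspaceFamily = record
    { Carrier   = Sub
    ; listing   = subsetListing (q ^ n)
    ; Member    = IsSubspace
    ; member?   = isSubspace?
    ; rank      = ρ
    ; size      = dim
    ; top       = ρ ⊤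
    ; rank≤top  = λ {V} V-sub → ρ-mono V ⊤ V-sub ⊤-isSubspace (λ _ → Subsetₚ.∈⊤)
    ; rank≤size = λ {V} V-sub → ρ-dim V (dim V) V-sub (hasDim-dim V)
    ; rankless  = span [] , span-isSubspace [] , ρ-zero
    ; topmost   = ⊤ , ⊤-isSubspace , refl
    }

  whitneyTermQ⇔ : ∀ i j V → WhitneyTermQ M i j V ⇔ RankedFamily.WhitneyTerm subspaceFamily i j V
  whitneyTermQ⇔ i j V = mk⇔
    (λ (V-sub , d , hasDim , e₁ , e₂) → V-sub , e₁ , subst (λ d → d ∸ ρ V ≡ j) (Equivalence.to (hasDim⇔ V-sub) hasDim) e₂)
    (λ (V-sub , e₁ , e₂) → V-sub , dim V , hasDim-dim V , e₁ , e₂)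

  module _ {m : ℕ} (e : LineEnum F n m) where
    open Lines e

    ρ-spanOf-≤ : ∀ A → ρ (spanOf A) ≤ ∣ A ∣
    ρ-spanOf-≤ A = ℕ.≤-trans (ρ-dim (spanOf A) _ (span-isSubspace (generators A)) (hasDim-dim (spanOf A))) (dim-spanOf-≤ A)

    projectiveFamily : RankedFamily
    projectiveFamily = record
      { Carrier   = Subset m
      ; listing   = subsetListing m
      ; Member    = λ _ → Unit.⊤
      ; member?   = λ _ → yes tt
      ; rank      = λ A → ρ (spanOf A)
      ; size      = ∣_∣
      ; top       = ρ (spanOf ⊤)
      ; rank≤top  = λ {A} _ → ρ-mono (spanOf A) (spanOf ⊤) (span-isSubspace (generators A)) (span-isSubspace (generators ⊤))
                                     (spanOf-mono (λ _ → Subsetₚ.∈⊤))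
      ; rank≤size = λ {A} _ → ρ-spanOf-≤ A
      ; rankless  = ⊥ , tt , ℕ.n≤0⇒n≡0 (subst (ρ (spanOf ⊥) ≤_) (Subsetₚ.∣⊥∣≡0 m) (ρ-spanOf-≤ ⊥))
      ; topmost   = ⊤ , tt , refl
      }

    projRank⇔ : ∀ A r → ProjRank M e A r ⇔ r ≡ ρ (spanOf A)
    projRank⇔ A r = mk⇔ (λ (W , W-spans , ρW≡r) → trans (sym ρW≡r) (cong ρ (spanOf-unique W-spans)))
                        (λ r≡ → spanOf A , spanOf-isLineSpan A , sym r≡)

    whitneyTermP⇔ : ∀ i j A → WhitneyTermP M e i j A ⇔ RankedFamily.WhitneyTerm projectiveFamily i j A
    whitneyTermP⇔ i j A = mk⇔
      (λ (rA , r⊤ , rankA , rank⊤ , e₁ , e₂) →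
        let rA≡ = Equivalence.to (projRank⇔ A rA) rankA ; r⊤≡ = Equivalence.to (projRank⇔ ⊤ r⊤) rank⊤ in
        tt , subst₂ (λ s t → s ∸ t ≡ i) r⊤≡ rA≡ e₁ , subst (λ t → ∣ A ∣ ∸ t ≡ j) rA≡ e₂)
      (λ (_ , e₁ , e₂) → ρ (spanOf A) , ρ (spanOf ⊤) , Equivalence.from (projRank⇔ A _) refl
                       , Equivalence.from (projRank⇔ ⊤ _) refl , e₁ , e₂)

    module _ (r k : ℕ) where
      private
        subsets : List Sub
        subsets = elems (subsetListing (q ^ n))

        pointSets : List (Subset m)
        pointSets = elems (subsetListing m)

        projectiveProfile? : Decidable (RankedFamily.HasProfile projectiveFamily r k)
        projectiveProfile? = RankedFamily.hasProfile? projectiveFamily r k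

        subspaceWeight : Sub → ℕ
        subspaceWeight W = 𝟙 (isSubspace? W ×-dec ρ W ℕ.≟ r) * spanningCount F (dim W) k

      fibre-by-span : ∀ W → ∑[ A ← pointSets ] (𝟙 (spanOf A ≟ₛ W) * 𝟙 (projectiveProfile? A))
                            ≡ 𝟙 (ρ W ℕ.≟ r) * spanningSets W k
      fibre-by-span W = trans (∑-cong pointSets λ {A} _ → pointwise A) (∑-*ˡ pointSets (𝟙 (ρ W ℕ.≟ r)) _)
        where
        pointwise : ∀ A → 𝟙 (spanOf A ≟ₛ W) * 𝟙 (projectiveProfile? A) ≡ 𝟙 (ρ W ℕ.≟ r) * 𝟙 (spanningSet? W k A)
        pointwise A = begin
          𝟙 span≟ * 𝟙 profile?          ≡⟨ 𝟙-× span≟ profile? ⟨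
          𝟙 (span≟ ×-dec profile?)       ≡⟨ 𝟙-cong (span≟ ×-dec profile?) ((ρ W ℕ.≟ r) ×-dec spanningSet? W k A)
                                              (λ { (refl , _ , ρ≡r , ∣A∣≡k) → ρ≡r , refl , ∣A∣≡k })
                                              (λ { (ρ≡r , refl , ∣A∣≡k) → refl , tt , ρ≡r , ∣A∣≡k }) ⟩
          𝟙 ((ρ W ℕ.≟ r) ×-dec spanningSet? W k A)  ≡⟨ 𝟙-× (ρ W ℕ.≟ r) (spanningSet? W k A) ⟩
          𝟙 (ρ W ℕ.≟ r) * 𝟙 (spanningSet? W k A)   ∎
          where
          open ≡-Reasoning
          span≟ = spanOf A ≟ₛ W
          profile? = projectiveProfile? A

      spanningSets-weight : ∀ W → 𝟙 (ρ W ℕ.≟ r) * spanningSets W k ≡ subspaceWeight W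
      spanningSets-weight W = by-cases (isSubspace? W)
        where
        by-cases : (W-sub? : Dec (IsSubspace W)) →
                   𝟙 (ρ W ℕ.≟ r) * spanningSets W k ≡ 𝟙 (W-sub? ×-dec ρ W ℕ.≟ r) * spanningCount F (dim W) k
        by-cases W-sub? = trans (by-cases′ W-sub?) (cong (_* spanningCount F (dim W) k) (sym (𝟙-× W-sub? (ρ W ℕ.≟ r))))
          where
          by-cases′ : (W-sub? : Dec (IsSubspace W)) →
                      𝟙 (ρ W ℕ.≟ r) * spanningSets W k ≡ 𝟙 W-sub? * 𝟙 (ρ W ℕ.≟ r) * spanningCount F (dim W) k
          by-cases′ (yes W-sub) = cong₂ _*_ (sym (ℕ.*-identityˡ (𝟙 (ρ W ℕ.≟ r)))) (spanningSets-dim e W-sub k)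
          by-cases′ (no ¬W-sub) =
            trans (cong (𝟙 (ρ W ℕ.≟ r) *_) (spanningSets-nonsubspace ¬W-sub k)) (ℕ.*-zeroʳ (𝟙 (ρ W ℕ.≟ r)))

      fibre-by-dim : ∀ d → ∑[ W ← subsets ] (𝟙 (dim W ℕ.≟ d) * subspaceWeight W)
                           ≡ RankedFamily.profile subspaceFamily r d * spanningCount F d k
      fibre-by-dim d = trans (∑-cong subsets λ {W} _ → pointwise W) (∑-*ʳ subsets _ (spanningCount F d k))
        where
        pointwise : ∀ W → 𝟙 (dim W ℕ.≟ d) * subspaceWeight W
                          ≡ 𝟙 (RankedFamily.hasProfile? subspaceFamily r d W) * spanningCount F d k
        pointwise W = by-cases (dim W ℕ.≟ d)
          where
          by-cases : ∀ {d} (dim≟d : Dec (dim W ≡ d)) → 𝟙 dim≟d * subspaceWeight W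
                                                   ≡ 𝟙 (RankedFamily.hasProfile? subspaceFamily r d W) * spanningCount F d k
          by-cases (yes refl) = trans (ℕ.*-identityˡ (subspaceWeight W)) (cong (_* spanningCount F (dim W) k)
            (𝟙-cong (isSubspace? W ×-dec ρ W ℕ.≟ r) (RankedFamily.hasProfile? subspaceFamily r (dim W) W)
              (λ (W-sub , ρ≡r) → W-sub , ρ≡r , refl) (λ (W-sub , ρ≡r , _) → W-sub , ρ≡r)))
          by-cases {d} (no dim≢d) = sym (cong (_* spanningCount F d k)
            (𝟙-no (RankedFamily.hasProfile? subspaceFamily r d W) λ (_ , _ , dim≡d) → dim≢d dim≡d))

      projective-profile : RankedFamily.profile projectiveFamily r k
                           ≡ ∑[ d ← downFrom (suc k) ] (RankedFamily.profile subspaceFamily r d * spanningCount F d k)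
      projective-profile = begin
        RankedFamily.profile projectiveFamily r k
          ≡⟨ ∑-fibres _≟ₛ_ pointSets subsets (unique (subsetListing (q ^ n))) spanOf
                      (λ A → 𝟙 (projectiveProfile? A))
                      (λ A span∉ → ⊥-elim (span∉ (complete (subsetListing (q ^ n)) (spanOf A)))) ⟩
        ∑[ W ← subsets ] ∑[ A ← pointSets ] (𝟙 (spanOf A ≟ₛ W) * 𝟙 (projectiveProfile? A))
          ≡⟨ ∑-cong subsets (λ {W} _ → trans (fibre-by-span W) (spanningSets-weight W)) ⟩
        ∑[ W ← subsets ] subspaceWeight W
          ≡⟨ ∑-fibres ℕ._≟_ subsets (downFrom (suc k)) (Unique.downFrom⁺ (suc k)) dim subspaceWeight
                      (λ W dim∉ → trans (cong (𝟙 (isSubspace? W ×-dec ρ W ℕ.≟ r) *_)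
                                             (spanningCount-below F (ℕ.≰⇒> (dim∉ ∘ ∈-downFrom⁺ ∘ s≤s))))
                                        (ℕ.*-zeroʳ (𝟙 (isSubspace? W ×-dec ρ W ℕ.≟ r)))) ⟩
        ∑[ d ← downFrom (suc k) ] ∑[ W ← subsets ] (𝟙 (dim W ℕ.≟ d) * subspaceWeight W)
          ≡⟨ ∑-cong (downFrom (suc k)) (λ {d} _ → fibre-by-dim d) ⟩
        ∑[ d ← downFrom (suc k) ] (RankedFamily.profile subspaceFamily r d * spanningCount F d k) ∎
        where open ≡-Reasoning

open Matroid using (subspaceFamily; projectiveFamily; whitneyTermQ⇔; whitneyTermP⇔; projective-profile)

sameSubspaceProfiles⇔sameProjectiveProfiles :
  ∀ {q} {F : FiniteField q} {n₁ n₂ m₁ m₂} (M₁ : QMatroid F n₁) (M₂ : QMatroid F n₂)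
  (e₁ : LineEnum F n₁ m₁) (e₂ : LineEnum F n₂ m₂) →
  SameProfiles (subspaceFamily M₁) (subspaceFamily M₂) ⇔ SameProfiles (projectiveFamily M₁ e₁) (projectiveFamily M₂ e₂)
sameSubspaceProfiles⇔sameProjectiveProfiles {F = F} M₁ M₂ e₁ e₂ = mk⇔
  (λ same r k → trans (projective-profile M₁ e₁ r k)
                  (trans (∑-cong (downFrom (suc k)) (λ {d} _ → cong (_* spanningCount F d k) (same r d)))
                         (sym (projective-profile M₂ e₂ r k))))
  (λ same r → triangular-injective (spanningCount F) (spanningCount-diagonal F)
                (profile (subspaceFamily M₁) r) (profile (subspaceFamily M₂) r)
                λ k → trans (sym (projective-profile M₁ e₁ r k)) (trans (same r k) (projective-profile M₂ e₂ r k)))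

theorem5p12 : ∀ {q : ℕ} (F : FiniteField q) {n₁ n₂ m₁ m₂ : ℕ}
                (M₁ : QMatroid F n₁) (M₂ : QMatroid F n₂)
                (e₁ : LineEnum F n₁ m₁) (e₂ : LineEnum F n₂ m₂) →
                WhitneyEqQ M₁ M₂ ⇔ WhitneyEqP M₁ e₁ M₂ e₂
theorem5p12 F M₁ M₂ e₁ e₂ = begin
  WhitneyEqQ M₁ M₂        ≈⟨ whitneyEq⇔sameCoefficients Q₁ Q₂ (whitneyTermQ⇔ M₁) (whitneyTermQ⇔ M₂) ⟩
  SameCoefficients Q₁ Q₂  ≈⟨ sameCoefficients⇔sameProfiles Q₁ Q₂ ⟩
  SameProfiles Q₁ Q₂      ≈⟨ sameSubspaceProfiles⇔sameProjectiveProfiles M₁ M₂ e₁ e₂ ⟩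
  SameProfiles P₁ P₂      ≈⟨ sameCoefficients⇔sameProfiles P₁ P₂ ⟨
  SameCoefficients P₁ P₂  ≈⟨ whitneyEq⇔sameCoefficients P₁ P₂ (whitneyTermP⇔ M₁ e₁) (whitneyTermP⇔ M₂ e₂) ⟨
  WhitneyEqP M₁ e₁ M₂ e₂  ∎
  where
  open Relation.Binary.Reasoning.Setoid (⇔-setoid Level.zero)
  Q₁ Q₂ P₁ P₂ : RankedFamily
  Q₁ = subspaceFamily M₁
  Q₂ = subspaceFamily M₂
  P₁ = projectiveFamily M₁ e₁
  P₂ = projectiveFamily M₂ e₂
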